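{- For every integer $n\geq 2$, the Gutman index of the pentagonal Möbius chain $P'_n$ is \[\operatorname{Gut}(P'_n)=\begin{cases}49n^3+64n^2-13n, & n \text{ even},\\ 49n^3+64n^2-14n, & n \text{ odd}.\end{cases}\]
   Context: For $n\geq 2$, $P'_n$ has vertex set $\{u_1,\dots,u_{2n}\}\cup\{u'_1,\dots,u'_{2n}\}\cup\{w_1,\dots,w_n\}$ and edges $u_ku_{k+1}$, $u'_ku'_{k+1}$ ($1\le k\le 2n-1$), $u_{2n}u'_1$, $u'_{2n}u_1$, $u_{2k-1}u'_{2k-1}$ ($1\le k\le n$), and $u_{2k}w_k$, $w_ku'_{2k}$ ($1\le k\le n$). For a connected graph with vertices $v_1,\dots,v_N$, degrees $d_i$ and shortest-path distances $d_{ij}$, the Gutman index is $\operatorname{Gut}(G)=\frac12\sum_{i=1}^N\sum_{j=1}^N d_id_jd_{ij}$. -}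

module Defs where

open import Data.Nat using (ℕ; zero; suc; _+_; _*_; _∸_; _<_; _≡ᵇ_; _<ᵇ_)
open import Data.Nat.DivMod using (_/_)
open import Data.Bool using (Bool; true; false; _∧_; _∨_; if_then_else_)
open import Data.List using (List; []; _∷_; _++_; map; upTo; length; filter; concatMap)
open import Data.Bool.ListAction using (any)
open import Data.Nat.ListAction using (sum)
open import Data.Product using (_×_; _,_)

-- A finite simple graph on vertices 0 … N-1, given by its (undirected) edge list.
record Graph : Set where
  field
    N     : ℕ
    edges : List (ℕ × ℕ)
open Graph public

adj : Graph → ℕ → ℕ → Bool
adj G a b = any (λ e → edgeIs e) (edges G)
  where
  edgeIs : ℕ × ℕ → Bool
  edgeIs (x , y) = ((x ≡ᵇ a) ∧ (y ≡ᵇ b)) ∨ ((x ≡ᵇ b) ∧ (y ≡ᵇ a))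

deg : Graph → ℕ → ℕ
deg G a = length (filter (λ c → Data.Bool._≟_ (adj G a c) true) (upTo (N G)))
  where import Data.Bool

within : Graph → ℕ → ℕ → ℕ → Bool
within G zero    a b = a ≡ᵇ b
within G (suc k) a b = within G k a b ∨ any (λ c → adj G a c ∧ within G k c b) (upTo (N G))

-- shortest-path distance: the least k with a walk of length ≤ k from a to b
-- (searching k = 0,1,…,fuel; for a connected graph on N vertices, fuel = N suffices)
distFrom : Graph → ℕ → ℕ → ℕ → ℕ → ℕ
distFrom G k zero       a b = k
distFrom G k (suc fuel) a b = if within G k a b then k else distFrom G (suc k) fuel a b

dist : Graph → ℕ → ℕ → ℕ
dist G a b = distFrom G 0 (N G) a b

gutman : Graph → ℕ
gutman G = sum (map (λ i → sum (map (λ j → deg G i * deg G j * dist G i j) vs)) vs) / 2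
  where vs = upTo (N G)

-- Pentagonal Möbius chain P'_n, 0-based vertex numbering:
--   u_{i+1}  ↦ i          (0 ≤ i < 2n)
--   u'_{i+1} ↦ 2n + i     (0 ≤ i < 2n)
--   w_{k+1}  ↦ 4n + k     (0 ≤ k < n)
module _ (n : ℕ) where
  private
    U  : ℕ → ℕ
    U i = i
    U' : ℕ → ℕ
    U' i = 2 * n + i
    W  : ℕ → ℕ
    W k = 4 * n + k

  pentEdges : List (ℕ × ℕ)
  pentEdges =
       -- u_k u_{k+1}, u'_k u'_{k+1}, 1 ≤ k ≤ 2n-1
       concatMap (λ i → (U i , U (suc i)) ∷ (U' i , U' (suc i)) ∷ []) (upTo (2 * n ∸ 1))
       -- u_{2n} u'_1 and u'_{2n} u_1
    ++ (U (2 * n ∸ 1) , U' 0) ∷ (U' (2 * n ∸ 1) , U 0) ∷ []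
       -- u_{2k-1} u'_{2k-1}, u_{2k} w_k, w_k u'_{2k}, 1 ≤ k ≤ n
    ++ concatMap (λ k → (U (2 * k) , U' (2 * k))
                      ∷ (U (2 * k + 1) , W k)
                      ∷ (W k , U' (2 * k + 1)) ∷ []) (upTo n)

  P′ : Graph
  P′ = record { N = 5 * n ; edges = pentEdges }

-- The u- and u′-vertices of P′ₙ form a cycle of length 4n (positions 0, …, 4n − 1); even
-- positions are joined to their antipode by a rung, odd ones to their antipode through a
-- common neighbour w.  We write the distance matrix down explicitly in terms of the cyclic
-- distance and certify it: it vanishes only on the diagonal, changes by at most one along
-- each edge, and from every other vertex some edge leads one step closer to a given target.
-- The neighbours of a vertex are then the vertices at distance one, giving degrees 3 and 2.
-- By the rotational symmetry of the cycle, each row sum of the distance matrix does not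
-- depend on the row and reduces to sums of tent functions, Σ_{c<K} min(c, K − c) = ⌊K²/4⌋;
-- the parity of n enters through the sum with K = n over the w-vertices.

module Submission where

open import Data.Bool using (Bool; true; false; T; _∧_; _∨_; if_then_else_)
import Data.Bool as Bool
open import Data.Bool.ListAction using (any)
open import Data.Bool.Properties using (T-∨; T-∧; T-≡)
open import Data.Empty using (⊥-elim)
open import Data.List using (List; _∷_; []; map; upTo; applyUpTo; length; filter; concatMap)
open import Data.List.Membership.Propositional using (_∈_; find; lose)
open import Data.List.Membership.Propositional.Properties
  using (∈-upTo⁺; ∈-upTo⁻; ∈-++⁻; ∈-++⁺ˡ; ∈-++⁺ʳ; ∈-concatMap⁻; ∈-concatMap⁺)
open import Data.List.Relation.Unary.Any using (here; there)
open import Data.List.Relation.Unary.Any.Properties using (any⁺; any⁻)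
open import Data.Nat
open import Data.Nat.DivMod using (m*n/n≡m; m≡m%n+[m/n]*n)
open import Data.Nat.ListAction using (sum)
open import Data.Nat.Properties
open import Data.Nat.Tactic.RingSolver using (solve-∀)
open import Data.Parity.Base using (Parity; 0ℙ; 1ℙ; _⁻¹)
import Data.Parity.Base as ℙ
open import Data.Parity.Properties using (+-homo-+; *-homo-*; suc-homo-⁻¹; ⁻¹-selfInverse)
open import Data.Product using (_×_; _,_; proj₁; proj₂; ∃-syntax)
open import Data.Sum using (_⊎_; inj₁; inj₂)
import Data.Sum as Sum
open import Defs
open import Function using (_∘_; id; _⇔_; Equivalence; mk⇔)
open import Relation.Binary using (tri<; tri≈; tri>)
open import Relation.Binary.PropositionalEquality
open import Relation.Nullary using (¬_; yes; no)
open import Algebra.Properties.CommutativeSemigroup +-commutativeSemigroup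
  using () renaming (interchange to +-interchange; x∙yz≈y∙xz to +-left-comm)
open import Algebra.Properties.CommutativeSemigroup *-commutativeSemigroup
  using () renaming (x∙yz≈y∙xz to *-left-comm)

open Equivalence using (to; from)

Σ< : ℕ → (ℕ → ℕ) → ℕ
Σ< zero    f = 0
Σ< (suc m) f = f 0 + Σ< m (f ∘ suc)

map-applyUpTo : ∀ {A : Set} (g : ℕ → A) (f : A → ℕ) m → map f (applyUpTo g m) ≡ applyUpTo (f ∘ g) m
map-applyUpTo g f zero    = refl
map-applyUpTo g f (suc m) = cong (f (g 0) ∷_) (map-applyUpTo (g ∘ suc) f m)

sum-applyUpTo : ∀ m (f : ℕ → ℕ) → sum (applyUpTo f m) ≡ Σ< m f
sum-applyUpTo zero    f = refl
sum-applyUpTo (suc m) f = cong (f 0 +_) (sum-applyUpTo m (f ∘ suc))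

sum-map-upTo : ∀ m (f : ℕ → ℕ) → sum (map f (upTo m)) ≡ Σ< m f
sum-map-upTo m f = trans (cong sum (map-applyUpTo id f m)) (sum-applyUpTo m f)

toℕ : Bool → ℕ
toℕ true  = 1
toℕ false = 0

length-filter-upTo : ∀ m (p : ℕ → Bool) →
  length (filter (λ c → p c Bool.≟ true) (upTo m)) ≡ Σ< m (toℕ ∘ p)
length-filter-upTo m p = go id m
  where
  go : ∀ (g : ℕ → ℕ) m → length (filter (λ c → p c Bool.≟ true) (applyUpTo g m)) ≡ Σ< m (toℕ ∘ p ∘ g)
  go g zero = refl
  go g (suc m) with p (g 0)
  ... | true  = cong suc (go (g ∘ suc) m)
  ... | false = go (g ∘ suc) m

T⇒toℕ≡1 : ∀ {b} → T b → toℕ b ≡ 1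
T⇒toℕ≡1 {true} _ = refl

¬T⇒toℕ≡0 : ∀ {b} → ¬ T b → toℕ b ≡ 0
¬T⇒toℕ≡0 {false} _  = refl
¬T⇒toℕ≡0 {true}  ¬t = ⊥-elim (¬t _)

toℕ-≡ᵇ : ∀ {m n} → m ≢ n → toℕ (m ≡ᵇ n) ≡ 0
toℕ-≡ᵇ {m} {n} m≢n = ¬T⇒toℕ≡0 (m≢n ∘ ≡ᵇ⇒≡ m n)

Σ<-cong : ∀ m {f g : ℕ → ℕ} → (∀ i → i < m → f i ≡ g i) → Σ< m f ≡ Σ< m g
Σ<-cong zero    f≡g = refl
Σ<-cong (suc m) f≡g = cong₂ _+_ (f≡g 0 z<s) (Σ<-cong m (λ i i<m → f≡g (suc i) (s<s i<m)))

Σ<-const : ∀ m c → Σ< m (λ _ → c) ≡ m * c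
Σ<-const zero    c = refl
Σ<-const (suc m) c = cong (c +_) (Σ<-const m c)

Σ<-const-on : ∀ m {f : ℕ → ℕ} {c} → (∀ i → i < m → f i ≡ c) → Σ< m f ≡ m * c
Σ<-const-on m {c = c} f≡c = trans (Σ<-cong m f≡c) (Σ<-const m c)

Σ<-zero : ∀ m {f : ℕ → ℕ} → (∀ i → i < m → f i ≡ 0) → Σ< m f ≡ 0
Σ<-zero m f≡0 = trans (Σ<-const-on m f≡0) (*-zeroʳ m)

Σ<-split : ∀ a b (f : ℕ → ℕ) → Σ< (a + b) f ≡ Σ< a f + Σ< b (λ i → f (a + i))
Σ<-split zero    b f = refl
Σ<-split (suc a) b f = trans (cong (f 0 +_) (Σ<-split a b (f ∘ suc))) (sym (+-assoc (f 0) _ _))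

Σ<-last : ∀ m (f : ℕ → ℕ) → Σ< (suc m) f ≡ Σ< m f + f m
Σ<-last m f = begin
  Σ< (suc m) f               ≡⟨ cong (λ k → Σ< k f) (+-comm 1 m) ⟩
  Σ< (m + 1) f               ≡⟨ Σ<-split m 1 f ⟩
  Σ< m f + (f (m + 0) + 0)   ≡⟨ cong (λ k → Σ< m f + k) (trans (+-identityʳ _) (cong f (+-identityʳ m))) ⟩
  Σ< m f + f m               ∎
  where open ≡-Reasoning

Σ<-+ : ∀ m (f g : ℕ → ℕ) → Σ< m (λ i → f i + g i) ≡ Σ< m f + Σ< m g
Σ<-+ zero    f g = refl
Σ<-+ (suc m) f g = trans (cong (f 0 + g 0 +_) (Σ<-+ m (f ∘ suc) (g ∘ suc)))
                         (+-interchange (f 0) (g 0) _ _)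

Σ<-* : ∀ m c (f : ℕ → ℕ) → Σ< m (λ i → c * f i) ≡ c * Σ< m f
Σ<-* zero    c f = sym (*-zeroʳ c)
Σ<-* (suc m) c f = trans (cong (c * f 0 +_) (Σ<-* m c (f ∘ suc))) (sym (*-distribˡ-+ c (f 0) _))

Σ<-swap : ∀ m l (f : ℕ → ℕ → ℕ) → Σ< m (λ i → Σ< l (f i)) ≡ Σ< l (λ j → Σ< m (λ i → f i j))
Σ<-swap zero    l f = sym (Σ<-zero l (λ _ _ → refl))
Σ<-swap (suc m) l f = trans (cong (Σ< l (f 0) +_) (Σ<-swap m l (f ∘ suc)))
                            (sym (Σ<-+ l (f 0) (λ j → Σ< m (λ i → f (suc i) j))))

Σ<-reverse : ∀ m (f : ℕ → ℕ) → Σ< m f ≡ Σ< m (λ i → f (m ∸ suc i))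
Σ<-reverse zero    f = refl
Σ<-reverse (suc m) f = begin
  f 0 + Σ< m (f ∘ suc)                                 ≡⟨ cong (f 0 +_) (Σ<-reverse m (f ∘ suc)) ⟩
  f 0 + Σ< m (λ i → f (suc (m ∸ suc i)))               ≡⟨ +-comm (f 0) _ ⟩
  Σ< m (λ i → f (suc (m ∸ suc i))) + f 0               ≡⟨ cong₂ _+_ (Σ<-cong m (λ i i<m → cong f (sym (+-∸-assoc 1 i<m))))
                                                                    (cong f (sym (n∸n≡0 m))) ⟩
  Σ< m (λ i → f (suc m ∸ suc i)) + f (suc m ∸ suc m)   ≡⟨ Σ<-last m (λ i → f (suc m ∸ suc i)) ⟨
  Σ< (suc m) (λ i → f (suc m ∸ suc i))                 ∎
  where open ≡-Reasoning

Σ<-none : ∀ m (p : ℕ → Bool) → (∀ {i} → i < m → ¬ T (p i)) → Σ< m (toℕ ∘ p) ≡ 0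
Σ<-none m p none = Σ<-zero m (λ i i<m → ¬T⇒toℕ≡0 (none i<m))

Σ<-unique : ∀ m (p : ℕ → Bool) {j} → j < m → T (p j) → (∀ {i} → i < m → T (p i) → i ≡ j) → Σ< m (toℕ ∘ p) ≡ 1
Σ<-unique (suc m) p {zero}  _         pj only = trans (cong (_+ Σ< m (toℕ ∘ p ∘ suc)) (T⇒toℕ≡1 pj))
  (cong suc (Σ<-none m (p ∘ suc) (λ i<m pi → 1+n≢0 (only (s<s i<m) pi))))
Σ<-unique (suc m) p {suc j} (s<s j<m) pj only = trans (cong (_+ Σ< m (toℕ ∘ p ∘ suc)) p0≡0)
  (Σ<-unique m (p ∘ suc) j<m pj (λ i<m pi → suc-injective (only (s<s i<m) pi)))
  where
  p0≡0 : toℕ (p 0) ≡ 0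
  p0≡0 with p 0 in eq
  ... | false = refl
  ... | true  = ⊥-elim (0≢1+n (only z<s (subst T (sym eq) _)))

Σ<-sparse : ∀ K (F : ℕ → ℕ) → 2 ≤ K → (∀ {c} → 2 ≤ c → c < K → F c ≡ 0) →
            Σ< K F + Σ< K (F ∘ suc) ≡ F 0 + (F 1 + F 1) + F K
Σ<-sparse (suc (suc K)) F (s≤s (s≤s z≤n)) F≡0 = begin
  F 0 + (F 1 + Σ< K (F ∘ suc ∘ suc)) + (F 1 + Σ< (suc K) (F ∘ suc ∘ suc))
    ≡⟨ cong₂ (λ a b → F 0 + (F 1 + a) + (F 1 + b)) tail≡0 (trans (Σ<-last K (F ∘ suc ∘ suc)) (cong (_+ F (2 + K)) tail≡0)) ⟩
  F 0 + (F 1 + 0) + (F 1 + (0 + F (2 + K)))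
    ≡⟨ regroup (F 0) (F 1) (F (2 + K)) ⟩
  F 0 + (F 1 + F 1) + F (2 + K) ∎
  where
  open ≡-Reasoning
  tail≡0 : Σ< K (F ∘ suc ∘ suc) ≡ 0
  tail≡0 = Σ<-zero K (λ i i<K → F≡0 (s≤s (s≤s z≤n)) (s<s (s<s i<K)))
  regroup : ∀ a b c → a + (b + 0) + (b + (0 + c)) ≡ a + (b + b) + c
  regroup = solve-∀

Near : ℕ → ℕ → Set
Near c c′ = c ≤ suc c′ × c′ ≤ suc c

Near-sym : ∀ {c c′} → Near c c′ → Near c′ c
Near-sym (p , q) = q , p

Near-refl : ∀ {c} → Near c c
Near-refl = n≤1+n _ , n≤1+n _

Near-suc : ∀ c → Near c (suc c)
Near-suc c = m≤n⇒m≤1+n (n≤1+n c) , ≤-refl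

∸-near : ∀ K {c c′} → c′ ≤ suc c → K ∸ c ≤ suc (K ∸ c′)
∸-near K {c} {zero}   _          = m≤n⇒m≤1+n (m∸n≤m K c)
∸-near K {c} {suc c′} (s≤s c′≤c) = ≤-trans (∸-monoʳ-≤ K c′≤c) (m∸n≤1+m∸[1+n] K c′)
  where
  m∸n≤1+m∸[1+n] : ∀ m t → m ∸ t ≤ suc (m ∸ suc t)
  m∸n≤1+m∸[1+n] zero    t       = subst (_≤ suc (0 ∸ suc t)) (sym (0∸n≡0 t)) z≤n
  m∸n≤1+m∸[1+n] (suc m) zero    = ≤-refl
  m∸n≤1+m∸[1+n] (suc m) (suc t) = m∸n≤1+m∸[1+n] m t

tent : ℕ → ℕ → ℕ
tent K c = c ⊓ (K ∸ c)

tent-near : ∀ K {c c′} → Near c c′ → Near (tent K c) (tent K c′)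
tent-near K (c≤ , c′≤) = ⊓-mono-≤ c≤ (∸-near K c′≤) , ⊓-mono-≤ c′≤ (∸-near K c≤)

tent-≤ : ∀ {K c} → c + c ≤ K → tent K c ≡ c
tent-≤ {c = c} 2c≤K = m≤n⇒m⊓n≡m (m+n≤o⇒m≤o∸n c 2c≤K)

tent-≥ : ∀ {K c} → K ≤ c + c → tent K c ≡ K ∸ c
tent-≥ {K} {c} K≤2c = m≥n⇒m⊓n≡n (m≤n+o⇒m∸n≤o K c K≤2c)

tent-reflect : ∀ {K c} → c ≤ K → tent K (K ∸ c) ≡ tent K c
tent-reflect {K} {c} c≤K = trans (cong ((K ∸ c) ⊓_) (m∸[m∸n]≡n c≤K)) (⊓-comm (K ∸ c) c)

tent-K : ∀ K → tent K K ≡ 0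
tent-K K = trans (cong (K ⊓_) (n∸n≡0 K)) (⊓-zeroʳ K)

tent≡0 : ∀ {K} c → tent K c ≡ 0 → c ≡ 0 ⊎ K ≤ c
tent≡0 {K} c t≡0 with ⊓-sel c (K ∸ c)
... | inj₁ t≡c  = inj₁ (trans (sym t≡c) t≡0)
... | inj₂ t≡K∸ = inj₂ (m∸n≡0⇒m≤n (trans (sym t≡K∸) t≡0))

tent≤half : ∀ L c → tent (L + L) c ≤ L
tent≤half L c with ≤-total c L
... | inj₁ c≤L = ≤-trans (m⊓n≤m c _) c≤L
... | inj₂ L≤c = ≤-trans (m⊓n≤n c _) (≤-trans (∸-monoʳ-≤ (L + L) L≤c) (≤-reflexive (m+n∸n≡m L L)))

tent-suc-up : ∀ {K c} → suc c + suc c ≤ K → tent K (suc c) ≡ suc (tent K c)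
tent-suc-up {K} {c} 2c+2≤K = trans (tent-≤ 2c+2≤K)
  (cong suc (sym (tent-≤ (≤-trans (+-monoʳ-≤ c (n≤1+n c)) (≤-trans (n≤1+n _) 2c+2≤K)))))

tent-suc-down : ∀ {K c} → K ≤ c + c → suc c ≤ K → suc (tent K (suc c)) ≡ tent K c
tent-suc-down {K} {c} K≤2c c<K = begin
  suc (tent K (suc c))  ≡⟨ cong suc (tent-≥ (≤-trans K≤2c (+-mono-≤ (n≤1+n c) (n≤1+n c)))) ⟩
  suc (K ∸ suc c)       ≡⟨ +-∸-assoc 1 c<K ⟨
  suc K ∸ suc c         ≡⟨ tent-≥ K≤2c ⟨
  tent K c              ∎
  where open ≡-Reasoning

tri : ℕ → ℕ
tri m = Σ< m (λ j → j)

tri-double : ∀ m → 2 * tri m + m ≡ m * m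
tri-double zero    = refl
tri-double (suc m) = begin
  2 * tri (suc m) + suc m     ≡⟨ cong (λ s → 2 * s + suc m) (Σ<-last m (λ j → j)) ⟩
  2 * (tri m + m) + suc m     ≡⟨ regroup (tri m) m ⟩
  (2 * tri m + m) + 2 * m + 1 ≡⟨ cong (λ s → s + 2 * m + 1) (tri-double m) ⟩
  m * m + 2 * m + 1           ≡⟨ square-suc m ⟩
  suc m * suc m               ∎
  where
  open ≡-Reasoning
  regroup : ∀ t m → 2 * (t + m) + suc m ≡ (2 * t + m) + 2 * m + 1
  regroup = solve-∀
  square-suc : ∀ m → m * m + 2 * m + 1 ≡ suc m * suc m
  square-suc = solve-∀

Σ<-∸ : ∀ m → Σ< m (m ∸_) ≡ m + tri m
Σ<-∸ m = begin
  Σ< m (m ∸_)                         ≡⟨ Σ<-reverse m _ ⟩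
  Σ< m (λ i → m ∸ (m ∸ suc i))        ≡⟨ Σ<-cong m (λ i i<m → m∸[m∸n]≡n i<m) ⟩
  Σ< m (λ i → 1 + i)                  ≡⟨ Σ<-+ m (λ _ → 1) (λ i → i) ⟩
  Σ< m (λ _ → 1) + tri m              ≡⟨ cong (_+ tri m) (trans (Σ<-const m 1) (*-identityʳ m)) ⟩
  m + tri m                           ∎
  where open ≡-Reasoning

Σ<-tent-even : ∀ q → Σ< (q + q) (tent (q + q)) ≡ q * q
Σ<-tent-even q = begin
  Σ< (q + q) (tent (q + q))                                 ≡⟨ Σ<-split q q _ ⟩
  Σ< q (tent (q + q)) + Σ< q (λ j → tent (q + q) (q + j))   ≡⟨ cong₂ _+_ (Σ<-cong q lower) (Σ<-cong q upper) ⟩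
  tri q + Σ< q (q ∸_)                                       ≡⟨ cong (tri q +_) (Σ<-∸ q) ⟩
  tri q + (q + tri q)                                       ≡⟨ regroup (tri q) q ⟩
  2 * tri q + q                                             ≡⟨ tri-double q ⟩
  q * q                                                     ∎
  where
  open ≡-Reasoning
  lower : ∀ j → j < q → tent (q + q) j ≡ j
  lower j j<q = tent-≤ (+-mono-≤ (<⇒≤ j<q) (<⇒≤ j<q))
  upper : ∀ j → j < q → tent (q + q) (q + j) ≡ q ∸ j
  upper j _ = trans (tent-≥ (+-mono-≤ (m≤m+n q j) (m≤m+n q j))) ([m+n]∸[m+o]≡n∸o q q j)
  regroup : ∀ t q → t + (q + t) ≡ 2 * t + q
  regroup = solve-∀

Σ<-tent-odd : ∀ q → Σ< (suc (q + q)) (tent (suc (q + q))) ≡ q * q + q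
Σ<-tent-odd q = begin
  Σ< (suc q + q) (tent (suc (q + q)))                                   ≡⟨ Σ<-split (suc q) q (tent (suc (q + q))) ⟩
  Σ< (suc q) (tent (suc (q + q))) + Σ< q (λ j → tent (suc (q + q)) (suc q + j))
                                                                        ≡⟨ cong₂ _+_ (trans (Σ<-cong (suc q) lower) (Σ<-last q (λ j → j)))
                                                                                     (Σ<-cong q upper) ⟩
  tri q + q + Σ< q (q ∸_)                                               ≡⟨ cong (tri q + q +_) (Σ<-∸ q) ⟩
  tri q + q + (q + tri q)                                               ≡⟨ regroup (tri q) q ⟩
  2 * tri q + q + q                                                     ≡⟨ cong (_+ q) (tri-double q) ⟩
  q * q + q                                                             ∎
  where
  open ≡-Reasoning
  lower : ∀ j → j < suc q → tent (suc (q + q)) j ≡ j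
  lower j j≤q = tent-≤ (≤-trans (+-mono-≤ (≤-pred j≤q) (≤-pred j≤q)) (n≤1+n _))
  upper : ∀ j → j < q → tent (suc (q + q)) (suc q + j) ≡ q ∸ j
  upper j _ = trans (tent-≥ (s≤s (≤-trans (+-mono-≤ (m≤m+n q j) (m≤m+n q j)) (+-monoʳ-≤ (q + j) (n≤1+n (q + j))))))
                    ([m+n]∸[m+o]≡n∸o q q j)
  regroup : ∀ t q → t + q + (q + t) ≡ 2 * t + q + q
  regroup = solve-∀

∣m+n-m∣≡n : ∀ m n → ∣ m + n - m ∣ ≡ n
∣m+n-m∣≡n m n = trans (∣-∣-comm (m + n) m) (∣m-m+n∣≡n m n)

Σ<-∣-∣ : ∀ K (G : ℕ → ℕ) {x} → x < K → (∀ {t} → 0 < t → t < K → G (K ∸ t) ≡ G t) →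
         Σ< K (λ c → G ∣ x - c ∣) ≡ Σ< K G
Σ<-∣-∣ K G {x} x<K G-reflect with r , refl ← m≤n⇒∃[o]m+o≡n (<⇒≤ x<K) = begin
  Σ< (x + r) (λ c → G ∣ x - c ∣)                           ≡⟨ Σ<-split x r _ ⟩
  Σ< x (λ c → G ∣ x - c ∣) + Σ< r (λ j → G ∣ x - x + j ∣)  ≡⟨ cong₂ _+_ (Σ<-reverse x _) (Σ<-cong r (λ j _ → cong G (∣m-m+n∣≡n x j))) ⟩
  Σ< x (λ i → G ∣ x - (x ∸ suc i) ∣) + Σ< r G              ≡⟨ cong (_+ Σ< r G) (Σ<-cong x below) ⟩
  Σ< x (λ i → G (r + (x ∸ suc i))) + Σ< r G                ≡⟨ cong (_+ Σ< r G) (Σ<-reverse x (λ i → G (r + i))) ⟨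
  Σ< x (λ i → G (r + i)) + Σ< r G                          ≡⟨ +-comm _ (Σ< r G) ⟩
  Σ< r G + Σ< x (λ i → G (r + i))                          ≡⟨ Σ<-split r x G ⟨
  Σ< (r + x) G                                             ≡⟨ cong (λ k → Σ< k G) (+-comm r x) ⟩
  Σ< (x + r) G                                             ∎
  where
  open ≡-Reasoning
  below : ∀ i → i < x → G ∣ x - (x ∸ suc i) ∣ ≡ G (r + (x ∸ suc i))
  below i i<x = begin
    G ∣ x - (x ∸ suc i) ∣  ≡⟨ cong G (trans (m≤n⇒∣n-m∣≡n∸m (m∸n≤m x (suc i))) (m∸[m∸n]≡n i<x)) ⟩
    G (suc i)              ≡⟨ G-reflect (s≤s z≤n) (≤-<-trans i<x x<K) ⟨
    G (x + r ∸ suc i)      ≡⟨ cong G (trans (cong (_∸ suc i) (+-comm x r)) (+-∸-assoc r i<x)) ⟩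
    G (r + (x ∸ suc i))    ∎

any-upTo⁻ : ∀ {m} (p : ℕ → Bool) → T (any p (upTo m)) → ∃[ i ] i < m × T (p i)
any-upTo⁻ p t with i , i∈ , pi ← find (any⁻ p _ t) = i , ∈-upTo⁻ i∈ , pi

any-upTo⁺ : ∀ {m} (p : ℕ → Bool) {i} → i < m → T (p i) → T (any p (upTo m))
any-upTo⁺ p i<m pi = any⁺ p (lose (∈-upTo⁺ i<m) pi)

edge? : ℕ → ℕ → ℕ × ℕ → Bool
edge? a b (x , y) = ((x ≡ᵇ a) ∧ (y ≡ᵇ b)) ∨ ((x ≡ᵇ b) ∧ (y ≡ᵇ a))

edge?⇔ : ∀ {a b x y} → T (edge? a b (x , y)) ⇔ ((x , y) ≡ (a , b) ⊎ (x , y) ≡ (b , a))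
edge?⇔ {a} {b} {x} {y} = mk⇔ sound complete
  where
  sound : T (edge? a b (x , y)) → (x , y) ≡ (a , b) ⊎ (x , y) ≡ (b , a)
  sound t with to T-∨ t
  ... | inj₁ t′ with xa , yb ← to T-∧ t′ = inj₁ (cong₂ _,_ (≡ᵇ⇒≡ x a xa) (≡ᵇ⇒≡ y b yb))
  ... | inj₂ t′ with xb , ya ← to T-∧ t′ = inj₂ (cong₂ _,_ (≡ᵇ⇒≡ x b xb) (≡ᵇ⇒≡ y a ya))
  complete : (x , y) ≡ (a , b) ⊎ (x , y) ≡ (b , a) → T (edge? a b (x , y))
  complete (inj₁ refl) = from T-∨ (inj₁ (from T-∧ (≡⇒≡ᵇ x x refl , ≡⇒≡ᵇ y y refl)))
  complete (inj₂ refl) = from T-∨ (inj₂ (from T-∧ (≡⇒≡ᵇ x x refl , ≡⇒≡ᵇ y y refl)))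

adj⇔∈edges : ∀ G {a b} → T (adj G a b) ⇔ ((a , b) ∈ edges G ⊎ (b , a) ∈ edges G)
adj⇔∈edges G {a} {b} = mk⇔ sound complete
  where
  sound : T (adj G a b) → (a , b) ∈ edges G ⊎ (b , a) ∈ edges G
  sound t with (x , y) , e∈ , te ← find (any⁻ (edge? a b) (edges G) t) with to (edge?⇔ {a} {b} {x} {y}) te
  ... | inj₁ refl = inj₁ e∈
  ... | inj₂ refl = inj₂ e∈
  complete : (a , b) ∈ edges G ⊎ (b , a) ∈ edges G → T (adj G a b)
  complete (inj₁ ab∈) = any⁺ (edge? a b) (lose ab∈ (from (edge?⇔ {a} {b}) (inj₁ refl)))
  complete (inj₂ ba∈) = any⁺ (edge? a b) (lose ba∈ (from (edge?⇔ {a} {b}) (inj₂ refl)))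

module DistanceCertificate
  (G : Graph) (D : ℕ → ℕ → ℕ)
  (D-refl    : ∀ {a} → a < N G → D a a ≡ 0)
  (D≡0⇒≡    : ∀ {a b} → a < N G → b < N G → D a b ≡ 0 → a ≡ b)
  (D-edge    : ∀ {a c b} → T (adj G a c) → b < N G → D a b ≤ suc (D c b))
  (D-descent : ∀ {a b} → a < N G → b < N G → a ≢ b →
               ∃[ c ] c < N G × T (adj G a c) × suc (D c b) ≡ D a b)
  (D-bounded : ∀ {a b} → a < N G → b < N G → D a b ≤ N G)
  where

  within⇒D≤ : ∀ k {a b} → a < N G → b < N G → T (within G k a b) → D a b ≤ k
  within⇒D≤ zero {a} {b} _ b< t rewrite ≡ᵇ⇒≡ a b t | D-refl b< = z≤n
  within⇒D≤ (suc k) {a} {b} a< b< t with to T-∨ t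
  ... | inj₁ t′ = m≤n⇒m≤1+n (within⇒D≤ k a< b< t′)
  ... | inj₂ t′ with c , c< , ac∧cb ← any-upTo⁻ (λ c → adj G a c ∧ within G k c b) t′
                 with ac , cb ← to T-∧ ac∧cb
    = ≤-trans (D-edge ac b<) (s≤s (within⇒D≤ k c< b< cb))

  D≤⇒within : ∀ k {a b} → a < N G → b < N G → D a b ≤ k → T (within G k a b)
  D≤⇒within zero {a} {b} a< b< D≤0 = ≡⇒≡ᵇ a b (D≡0⇒≡ a< b< (n≤0⇒n≡0 D≤0))
  D≤⇒within (suc k) {a} {b} a< b< D≤ with m≤n⇒m<n∨m≡n D≤
  ... | inj₁ D<  = from T-∨ (inj₁ (D≤⇒within k a< b< (≤-pred D<)))
  ... | inj₂ D≡1+k with c , c< , ac , step ← D-descent a< b< (λ { refl → 0≢1+n (trans (sym (D-refl a<)) D≡1+k) })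
    = from T-∨ (inj₂ (any-upTo⁺ (λ c → adj G a c ∧ within G k c b) c<
                   (from T-∧ (ac , D≤⇒within k c< b< (≤-reflexive (suc-injective (trans step D≡1+k)))))))

  distFrom≡D : ∀ fuel k {a b} → a < N G → b < N G → k ≤ D a b → D a b ≤ k + fuel →
               distFrom G k fuel a b ≡ D a b
  distFrom≡D zero k {a} {b} a< b< k≤D D≤ = ≤-antisym k≤D (subst (D a b ≤_) (+-identityʳ k) D≤)
  distFrom≡D (suc fuel) k {a} {b} a< b< k≤D D≤ with within G k a b in eq
  ... | true  = ≤-antisym k≤D (within⇒D≤ k a< b< (subst T (sym eq) _))
  ... | false with m≤n⇒m<n∨m≡n k≤D
  ...   | inj₁ k<D = distFrom≡D fuel (suc k) a< b< k<D (subst (D a b ≤_) (+-suc k fuel) D≤)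
  ...   | inj₂ refl with () ← subst T eq (D≤⇒within k a< b< ≤-refl)

  dist≡D : ∀ {a b} → a < N G → b < N G → dist G a b ≡ D a b
  dist≡D a< b< = distFrom≡D (N G) 0 a< b< z≤n (D-bounded a< b<)

  D≡1⇒≢ : ∀ {a c} → a < N G → D a c ≡ 1 → a ≢ c
  D≡1⇒≢ a< D≡1 refl = 0≢1+n (trans (sym (D-refl a<)) D≡1)

  adj⇒D≡1 : (∀ a → ¬ T (adj G a a)) → ∀ {a c} → a < N G → c < N G → T (adj G a c) → D a c ≡ 1
  adj⇒D≡1 loopless {a} {c} a< c< ac with D a c in eq | D-edge ac c<
  ... | 0           | _ = ⊥-elim (loopless a (subst (λ x → T (adj G a x)) (sym (D≡0⇒≡ a< c< eq)) ac))
  ... | 1           | _ = refl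
  ... | suc (suc _) | s≤s D≤1+Dcc rewrite D-refl c< with () ← D≤1+Dcc

  D≡1⇒adj : ∀ {a c} → a < N G → c < N G → D a c ≡ 1 → T (adj G a c)
  D≡1⇒adj a< c< D≡1 with d , d< , ad , step ← D-descent a< c< (D≡1⇒≢ a< D≡1)
                    with refl ← D≡0⇒≡ d< c< (suc-injective (trans step D≡1)) = ad

  adj≡D≡ᵇ1 : (∀ a → ¬ T (adj G a a)) → ∀ {a c} → a < N G → c < N G → adj G a c ≡ (D a c ≡ᵇ 1)
  adj≡D≡ᵇ1 loopless {a} {c} a< c< with adj G a c in eq | D a c ≡ᵇ 1 in eq′
  ... | true  | true  = refl
  ... | false | false = refl
  ... | true  | false with () ← subst T eq′ (≡⇒≡ᵇ _ 1 (adj⇒D≡1 loopless a< c< (subst T (sym eq) _)))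
  ... | false | true  with () ← subst T eq (D≡1⇒adj a< c< (≡ᵇ⇒≡ _ 1 (subst T (sym eq′) _)))

  deg≡#D≡1 : (∀ a → ¬ T (adj G a a)) → ∀ {a} → a < N G → deg G a ≡ Σ< (N G) (λ c → toℕ (D a c ≡ᵇ 1))
  deg≡#D≡1 loopless a< = trans (length-filter-upTo (N G) _)
                                 (Σ<-cong (N G) (λ c c< → cong toℕ (adj≡D≡ᵇ1 loopless a< c<)))

module Cycle (L : ℕ) where

  M : ℕ
  M = L + L

  cd : ℕ → ℕ → ℕ
  cd x y = tent M ∣ x - y ∣

  cd-sym : ∀ x y → cd x y ≡ cd y x
  cd-sym x y = cong (tent M) (∣-∣-comm x y)

  cd-self : ∀ x → cd x x ≡ 0
  cd-self x = cong (tent M) (∣n-n∣≡0 x)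

  cd-+ : ∀ x k → cd x (x + k) ≡ tent M k
  cd-+ x k = cong (tent M) (∣m-m+n∣≡n x k)

  cd-+ˡ : ∀ y k → cd (y + k) y ≡ tent M k
  cd-+ˡ y k = cong (tent M) (∣m+n-m∣≡n y k)

  cd≤L : ∀ x y → cd x y ≤ L
  cd≤L x y = tent≤half L ∣ x - y ∣

  tent-lower : ∀ {c} → c ≤ L → tent M c ≡ c
  tent-lower c≤L = tent-≤ (+-mono-≤ c≤L c≤L)

  tent-upper : ∀ {d} → d ≤ L → tent M (L + d) ≡ L ∸ d
  tent-upper {d} d≤L = trans (tent-≥ (+-mono-≤ (m≤m+n L d) (m≤m+n L d))) ([m+n]∸[m+o]≡n∸o L L d)

  cd≡0⇒≡ : ∀ {x y} → x < M → y < M → cd x y ≡ 0 → x ≡ y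
  cd≡0⇒≡ {x} {y} x<M y<M cd≡0 with tent≡0 ∣ x - y ∣ cd≡0
  ... | inj₁ ∣x-y∣≡0 = ∣m-n∣≡0⇒m≡n ∣x-y∣≡0
  ... | inj₂ M≤∣x-y∣ = ⊥-elim (<-irrefl refl (≤-trans (≤-trans (s≤s M≤∣x-y∣) (s≤s (∣m-n∣≤m⊔n x y))) (⊔-lub x<M y<M)))

  cd-near-suc : ∀ x y → Near (cd x y) (cd (suc x) y)
  cd-near-suc x y = tent-near M (go x y)
    where
    go : ∀ x y → Near ∣ x - y ∣ ∣ suc x - y ∣
    go zero    zero    = Near-suc 0
    go (suc x) zero    = Near-suc (suc x)
    go zero    (suc y) = Near-sym (Near-suc y)
    go (suc x) (suc y) = go x y

  cd-wrap : ∀ {y} → y < M → cd (M ∸ 1) y ≡ tent M (suc y)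
  cd-wrap {y} y<M = begin
    tent M ∣ M ∸ 1 - y ∣   ≡⟨ cong (tent M) (m≤n⇒∣n-m∣≡n∸m (∸-monoˡ-≤ 1 y<M)) ⟩
    tent M (M ∸ 1 ∸ y)     ≡⟨ cong (tent M) (∸-+-assoc M 1 y) ⟩
    tent M (M ∸ suc y)     ≡⟨ tent-reflect y<M ⟩
    tent M (suc y)         ∎
    where open ≡-Reasoning

  tent-antipodal : ∀ {d} → d ≤ L → tent M (L + d) + tent M d ≡ L
  tent-antipodal d≤L = trans (cong₂ _+_ (tent-upper d≤L) (tent-lower d≤L)) (m∸n+n≡m d≤L)

  cd-antipodal : ∀ {x y} → x < L → y < M → cd (L + x) y + cd x y ≡ L
  cd-antipodal {x} {y} x<L y<M with ≤-total y x
  ... | inj₁ y≤x with d , refl ← m≤n⇒∃[o]m+o≡n y≤x = begin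
      cd (L + (y + d)) y + cd (y + d) y   ≡⟨ cong (λ z → cd z y + cd (y + d) y) (+-left-comm L y d) ⟩
      cd (y + (L + d)) y + cd (y + d) y   ≡⟨ cong₂ _+_ (cd-+ˡ y (L + d)) (cd-+ˡ y d) ⟩
      tent M (L + d) + tent M d           ≡⟨ tent-antipodal (≤-trans (m≤n+m d y) (<⇒≤ x<L)) ⟩
      L                                   ∎
    where open ≡-Reasoning
  ... | inj₂ x≤y with d , refl ← m≤n⇒∃[o]m+o≡n x≤y with ≤-total d L
  ...   | inj₁ d≤L = begin
      cd (L + x) (x + d) + cd x (x + d)              ≡⟨ cong (λ z → cd z (x + d) + cd x (x + d)) L+x≡ ⟩
      cd (x + d + (L ∸ d)) (x + d) + cd x (x + d)    ≡⟨ cong₂ _+_ (cd-+ˡ (x + d) (L ∸ d)) (cd-+ x d) ⟩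
      tent M (L ∸ d) + tent M d                      ≡⟨ cong₂ _+_ (tent-lower (m∸n≤m L d)) (tent-lower d≤L) ⟩
      L ∸ d + d                                      ≡⟨ m∸n+n≡m d≤L ⟩
      L                                              ∎
    where
    open ≡-Reasoning
    L+x≡ : L + x ≡ x + d + (L ∸ d)
    L+x≡ = trans (+-comm L x) (trans (cong (x +_) (sym (m+[n∸m]≡n d≤L))) (sym (+-assoc x d (L ∸ d))))
  ...   | inj₂ L≤d with e , refl ← m≤n⇒∃[o]m+o≡n L≤d = begin
      cd (L + x) (x + (L + e)) + cd x (x + (L + e))  ≡⟨ cong (λ z → cd (L + x) z + cd x (x + (L + e))) (+-left-comm x L e) ⟩
      cd (L + x) (L + (x + e)) + cd x (x + (L + e))  ≡⟨ cong (λ z → cd (L + x) z + cd x (x + (L + e))) (sym (+-assoc L x e)) ⟩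
      cd (L + x) (L + x + e) + cd x (x + (L + e))    ≡⟨ cong₂ _+_ (cd-+ (L + x) e) (cd-+ x (L + e)) ⟩
      tent M e + tent M (L + e)                      ≡⟨ +-comm (tent M e) _ ⟩
      tent M (L + e) + tent M e                      ≡⟨ tent-antipodal (+-cancelˡ-≤ L e L (≤-trans (m≤n+m (L + e) x) (<⇒≤ y<M))) ⟩
      L                                              ∎
    where open ≡-Reasoning

  data Next : ℕ → ℕ → Set where
    next : ∀ {x} → suc x < M → Next x (suc x)
    wrap : Next (M ∸ 1) 0

  Step : ℕ → ℕ → Set
  Step x x′ = Next x x′ ⊎ Next x′ x

  Step-< : ∀ {x x′} → x < M → Step x x′ → x′ < M
  Step-< _   (inj₁ (next x′<M)) = x′<M
  Step-< x<M (inj₁ wrap)        = ≤-trans (s≤s z≤n) x<M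
  Step-< x<M (inj₂ (next _))    = ≤-trans (n≤1+n _) x<M
  Step-< x<M (inj₂ wrap)        = ∸-monoʳ-< z<s x<M

  cd-Next : ∀ {x x′ y} → Next x x′ → y < M → Near (cd x y) (cd x′ y)
  cd-Next {y = y} (next _) _   = cd-near-suc _ y
  cd-Next {y = y} wrap     y<M rewrite cd-wrap y<M = Near-sym (tent-near M (Near-suc y))

  cd-Step : ∀ {x x′ y} → Step x x′ → y < M → Near (cd x y) (cd x′ y)
  cd-Step (inj₁ nx) y<M = cd-Next nx y<M
  cd-Step (inj₂ nx) y<M = Near-sym (cd-Next nx y<M)

  cd-suc+ : ∀ x k → cd x (suc (x + k)) ≡ tent M (suc k)
  cd-suc+ x k = trans (cong (cd x) (sym (+-suc x k))) (cd-+ x (suc k))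

  cd-suc+ˡ : ∀ y k → cd (suc (y + k)) y ≡ tent M (suc k)
  cd-suc+ˡ y k = trans (cd-sym (suc (y + k)) y) (cd-suc+ y k)

  tent-suc-lower : ∀ {c} → suc c ≤ L → suc (tent M c) ≡ tent M (suc c)
  tent-suc-lower c<L = sym (tent-suc-up (+-mono-≤ c<L c<L))

  tent-suc-upper : ∀ {c} → L ≤ suc c → suc (suc c) ≤ M → suc (tent M (suc (suc c))) ≡ tent M (suc c)
  tent-suc-upper L≤c c<M = tent-suc-down (+-mono-≤ L≤c L≤c) c<M

  Descent : ℕ → ℕ → Set
  Descent x y = ∃[ x′ ] Step x x′ × suc (cd x′ y) ≡ cd x y

  descent-forward : ∀ x d → suc (x + d) < M → Descent x (suc (x + d))
  descent-forward x d y<M with ≤-total (suc d) L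
  descent-forward x d y<M | inj₁ d<L = suc x , inj₁ (next (≤-<-trans (s≤s (m≤m+n x d)) y<M)) ,
      trans (cong suc (cd-+ (suc x) d)) (trans (tent-suc-lower d<L) (sym (cd-suc+ x d)))
  descent-forward zero d y<M | inj₂ L≤d = M ∸ 1 , inj₂ wrap ,
      trans (cong suc (cd-wrap y<M)) (tent-suc-upper L≤d y<M)
  descent-forward (suc x) d y<M | inj₂ L≤d = x , inj₂ (next (≤-trans (s≤s (s≤s (m≤m+n x d))) (<⇒≤ y<M))) ,
      trans (cong suc (trans (cong (λ z → cd x (suc z)) (sym (+-suc x d))) (cd-suc+ x (suc d))))
            (trans (tent-suc-upper L≤d (≤-trans (s≤s (s≤s (m≤n+m d x))) (<⇒≤ y<M))) (sym (cd-suc+ (suc x) d)))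

  descent-backward : ∀ y d → suc (y + d) < M → Descent (suc (y + d)) y
  descent-backward y d x<M with ≤-total (suc d) L
  ... | inj₁ d<L = y + d , inj₂ (next x<M) ,
      trans (cong suc (cd-+ˡ y d)) (trans (tent-suc-lower d<L) (sym (cd-suc+ˡ y d)))
  ... | inj₂ L≤d with suc (suc (y + d)) <? M
  ...   | yes x+1<M = suc (suc (y + d)) , inj₁ (next x+1<M) ,
      trans (cong suc (trans (cong (λ z → cd (suc z) y) (sym (+-suc y d))) (cd-suc+ˡ y (suc d))))
            (trans (tent-suc-upper L≤d (≤-trans (s≤s (s≤s (m≤n+m d y))) (<⇒≤ x+1<M))) (sym (cd-suc+ˡ y d)))
  ...   | no  x+1≮M = 0 , subst (λ z → Step z 0) (sym x≡M-1) (inj₁ wrap) ,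
      trans (tent-suc-lower y<L) (sym (trans (cong (λ z → cd z y) x≡M-1) (cd-wrap y<M)))
    where
    x+1≡M : suc (suc (y + d)) ≡ M
    x+1≡M = ≤-antisym x<M (≮⇒≥ x+1≮M)
    x≡M-1 : suc (y + d) ≡ M ∸ 1
    x≡M-1 = cong (_∸ 1) x+1≡M
    y<M : y < M
    y<M = ≤-trans (s≤s (m≤m+n y d)) (<⇒≤ x<M)
    y<L : suc y ≤ L
    y<L = +-cancelʳ-≤ L (suc y) L (≤-trans (+-monoʳ-≤ (suc y) L≤d)
            (≤-reflexive (trans (cong suc (+-suc y d)) x+1≡M)))

  cd-descent : ∀ {x y} → x < M → y < M → x ≢ y → Descent x y
  cd-descent {x} {y} x<M y<M x≢y with <-cmp x y
  ... | tri≈ _ x≡y _ = ⊥-elim (x≢y x≡y)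
  ... | tri< x<y _ _ with d , refl ← m≤n⇒∃[o]m+o≡n x<y = descent-forward x d y<M
  ... | tri> _ _ y<x with d , refl ← m≤n⇒∃[o]m+o≡n y<x = descent-backward y d x<M

  antipode : ∀ {y} → y < M → ∃[ ȳ ] ȳ < M × (∀ {z} → z < M → cd z y + cd z ȳ ≡ L)
  antipode {y} y<M with y <? L
  ... | yes y<L = L + y , +-monoʳ-< L y<L , λ {z} z<M →
      trans (cong₂ _+_ (cd-sym z y) (cd-sym z (L + y))) (trans (+-comm (cd y z) _) (cd-antipodal y<L z<M))
  ... | no  y≮L with y₀ , refl ← m≤n⇒∃[o]m+o≡n (≮⇒≥ y≮L) = y₀ , ≤-trans y₀<L (m≤m+n L L) , λ {z} z<M →
      trans (cong₂ _+_ (cd-sym z (L + y₀)) (cd-sym z y₀)) (cd-antipodal y₀<L z<M)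
    where
    y₀<L : y₀ < L
    y₀<L = +-cancelˡ-< L y₀ L y<M

  -- Moving away from y is moving towards its antipode.
  cd-ascent : ∀ {x y} → x < M → y < M → cd x y < L → ∃[ x′ ] Step x x′ × cd x′ y ≡ suc (cd x y)
  cd-ascent {x} {y} x<M y<M cd<L with ȳ , ȳ<M , cd+cd≡L ← antipode y<M = ascend (cd-descent x<M ȳ<M x≢ȳ)
    where
    x≢ȳ : x ≢ ȳ
    x≢ȳ refl = <-irrefl (trans (sym (+-identityʳ _)) (trans (cong (cd x y +_) (sym (cd-self x))) (cd+cd≡L x<M))) cd<L
    ascend : Descent x ȳ → ∃[ x′ ] Step x x′ × cd x′ y ≡ suc (cd x y)
    ascend (x′ , step , closer) = x′ , step , +-cancelʳ-≡ (cd x′ ȳ) _ _ (begin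
      cd x′ y + cd x′ ȳ         ≡⟨ cd+cd≡L (Step-< x<M step) ⟩
      L                          ≡⟨ cd+cd≡L x<M ⟨
      cd x y + cd x ȳ           ≡⟨ cong (cd x y +_) closer ⟨
      cd x y + suc (cd x′ ȳ)    ≡⟨ +-suc (cd x y) (cd x′ ȳ) ⟩
      suc (cd x y) + cd x′ ȳ    ∎)
      where open ≡-Reasoning

  Σ<-tent : ∀ (F : ℕ → ℕ) → Σ< M (F ∘ tent M) ≡ Σ< L F + Σ< L (F ∘ suc)
  Σ<-tent F = begin
    Σ< (L + L) (F ∘ tent M)                                ≡⟨ Σ<-split L L _ ⟩
    Σ< L (F ∘ tent M) + Σ< L (λ j → F (tent M (L + j)))   ≡⟨ cong₂ _+_ (Σ<-cong L (λ t t<L → cong F (tent-lower (<⇒≤ t<L))))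
                                                                        (Σ<-cong L (λ j j<L → cong F (tent-upper (<⇒≤ j<L)))) ⟩
    Σ< L F + Σ< L (λ j → F (L ∸ j))                       ≡⟨ cong (Σ< L F +_) (Σ<-reverse L _) ⟩
    Σ< L F + Σ< L (λ i → F (L ∸ (L ∸ suc i)))             ≡⟨ cong (Σ< L F +_) (Σ<-cong L (λ i i<L → cong F (m∸[m∸n]≡n i<L))) ⟩
    Σ< L F + Σ< L (F ∘ suc)                               ∎
    where open ≡-Reasoning

  Σ<-cd : ∀ (F : ℕ → ℕ) {x} → x < M → Σ< M (λ y → F (cd x y)) ≡ Σ< L F + Σ< L (F ∘ suc)
  Σ<-cd F x<M = trans (Σ<-∣-∣ M (F ∘ tent M) x<M (λ _ t<M → cong F (tent-reflect (<⇒≤ t<M)))) (Σ<-tent F)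

<⇒<ᵇ≡true : ∀ {m n} → m < n → (m <ᵇ n) ≡ true
<⇒<ᵇ≡true m<n = to T-≡ (<⇒<ᵇ m<n)

≤⇒<ᵇ≡false : ∀ {m n} → n ≤ m → (m <ᵇ n) ≡ false
≤⇒<ᵇ≡false {m} {n} n≤m with m <ᵇ n in eq
... | false = refl
... | true  = ⊥-elim (<⇒≱ (<ᵇ⇒< m n (subst T (sym eq) _)) n≤m)

if-true : ∀ {A : Set} {b} {u v : A} → b ≡ true → (if b then u else v) ≡ u
if-true refl = refl

if-false : ∀ {A : Set} {b} {u v : A} → b ≡ false → (if b then u else v) ≡ v
if-false refl = refl

parity-2* : ∀ k → parity (2 * k) ≡ 0ℙ
parity-2* k = *-homo-* 2 k

parity-2*+ : ∀ k x → parity (2 * k + x) ≡ parity x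
parity-2*+ k x = trans (+-homo-+ (2 * k) x) (cong (ℙ._+ parity x) (parity-2* k))

parity-2*+1 : ∀ k → parity (2 * k + 1) ≡ 1ℙ
parity-2*+1 k = parity-2*+ k 1

parity-suc : ∀ x → parity (suc x) ≡ parity x ⁻¹
parity-suc x = sym (trans (cong _⁻¹ (sym (suc-homo-⁻¹ x))) (⁻¹-selfInverse refl))

even-or-odd : ∀ y → ∃[ k ] (y ≡ 2 * k ⊎ y ≡ 2 * k + 1)
even-or-odd zero = 0 , inj₁ refl
even-or-odd (suc y) with even-or-odd y
... | k , inj₁ refl = k , inj₂ (+-comm 1 (2 * k))
... | k , inj₂ refl = suc k , inj₁ (trans (cong suc (+-comm (2 * k) 1)) (sym (*-suc 2 k)))

parity-cases : ∀ x → parity x ≡ 0ℙ ⊎ parity x ≡ 1ℙ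
parity-cases x with parity x
... | 0ℙ = inj₁ refl
... | 1ℙ = inj₂ refl

oddness : Parity → ℕ
oddness 0ℙ = 0
oddness 1ℙ = 1

Σ<-parity : ∀ q (f : Parity → ℕ) → Σ< (2 * q) (f ∘ parity) ≡ q * (f 0ℙ + f 1ℙ)
Σ<-parity zero    f = refl
Σ<-parity (suc q) f = begin
  Σ< (2 * suc q) (f ∘ parity)                    ≡⟨ cong (λ K → Σ< K (f ∘ parity)) (*-suc 2 q) ⟩
  f 0ℙ + (f 1ℙ + Σ< (2 * q) (f ∘ parity))         ≡⟨ cong (λ s → f 0ℙ + (f 1ℙ + s)) (Σ<-parity q f) ⟩
  f 0ℙ + (f 1ℙ + q * (f 0ℙ + f 1ℙ))               ≡⟨ sym (+-assoc (f 0ℙ) (f 1ℙ) _) ⟩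
  suc q * (f 0ℙ + f 1ℙ)                          ∎
  where open ≡-Reasoning

5n≡W+n : ∀ n → 5 * n ≡ 4 * n + n
5n≡W+n = solve-∀

module Chain (n : ℕ) where

  L : ℕ
  L = 2 * n

  data Edge : ℕ → ℕ → Set where
    uu   : ∀ {i} → i < L ∸ 1 → Edge i (suc i)
    u′u′ : ∀ {i} → i < L ∸ 1 → Edge (L + i) (L + suc i)
    uu′  : Edge (L ∸ 1) (L + 0)
    u′u  : Edge (L + (L ∸ 1)) 0
    rung : ∀ {k} → k < n → Edge (2 * k) (L + 2 * k)
    uw   : ∀ {k} → k < n → Edge (2 * k + 1) (4 * n + k)
    wu′  : ∀ {k} → k < n → Edge (4 * n + k) (L + (2 * k + 1))

  pathPairs : ℕ → List (ℕ × ℕ)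
  pathPairs i = (i , suc i) ∷ (L + i , L + suc i) ∷ []

  wrapPairs : List (ℕ × ℕ)
  wrapPairs = (L ∸ 1 , L + 0) ∷ (L + (L ∸ 1) , 0) ∷ []

  spokePairs : ℕ → List (ℕ × ℕ)
  spokePairs k = (2 * k , L + 2 * k) ∷ (2 * k + 1 , 4 * n + k) ∷ (4 * n + k , L + (2 * k + 1)) ∷ []

  ∈pentEdges⇒Edge : ∀ {x y} → (x , y) ∈ pentEdges n → Edge x y
  ∈pentEdges⇒Edge xy∈ with ∈-++⁻ (concatMap pathPairs (upTo (L ∸ 1))) xy∈
  ... | inj₁ ∈paths with i , i∈ , xy∈′ ← find (∈-concatMap⁻ pathPairs {xs = upTo (L ∸ 1)} ∈paths) with xy∈′
  ...   | here refl         = uu (∈-upTo⁻ i∈)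
  ...   | there (here refl) = u′u′ (∈-upTo⁻ i∈)
  ∈pentEdges⇒Edge xy∈ | inj₂ ∈rest with ∈-++⁻ wrapPairs ∈rest
  ... | inj₁ (here refl)         = uu′
  ... | inj₁ (there (here refl)) = u′u
  ... | inj₂ ∈spokes with k , k∈ , xy∈′ ← find (∈-concatMap⁻ spokePairs {xs = upTo n} ∈spokes) with xy∈′
  ...   | here refl                 = rung (∈-upTo⁻ k∈)
  ...   | there (here refl)         = uw (∈-upTo⁻ k∈)
  ...   | there (there (here refl)) = wu′ (∈-upTo⁻ k∈)

  ∈paths : ∀ {i e} → i < L ∸ 1 → e ∈ pathPairs i → e ∈ pentEdges n
  ∈paths i< e∈ = ∈-++⁺ˡ (∈-concatMap⁺ pathPairs (lose (∈-upTo⁺ i<) e∈))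

  ∈spokes : ∀ {k e} → k < n → e ∈ spokePairs k → e ∈ pentEdges n
  ∈spokes k< e∈ = ∈-++⁺ʳ (concatMap pathPairs (upTo (L ∸ 1)))
                    (∈-++⁺ʳ wrapPairs (∈-concatMap⁺ spokePairs (lose (∈-upTo⁺ k<) e∈)))

  ∈wraps : ∀ {e} → e ∈ wrapPairs → e ∈ pentEdges n
  ∈wraps e∈ = ∈-++⁺ʳ (concatMap pathPairs (upTo (L ∸ 1))) (∈-++⁺ˡ e∈)

  Edge⇒∈pentEdges : ∀ {x y} → Edge x y → (x , y) ∈ pentEdges n
  Edge⇒∈pentEdges (uu i<)   = ∈paths i< (here refl)
  Edge⇒∈pentEdges (u′u′ i<) = ∈paths i< (there (here refl))
  Edge⇒∈pentEdges uu′       = ∈wraps (here refl)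
  Edge⇒∈pentEdges u′u       = ∈wraps (there (here refl))
  Edge⇒∈pentEdges (rung k<) = ∈spokes k< (here refl)
  Edge⇒∈pentEdges (uw k<)   = ∈spokes k< (there (here refl))
  Edge⇒∈pentEdges (wu′ k<)  = ∈spokes k< (there (there (here refl)))

  Adjacent : ℕ → ℕ → Set
  Adjacent a c = Edge a c ⊎ Edge c a

  adj⇔Adjacent : ∀ {a c} → T (adj (P′ n) a c) ⇔ Adjacent a c
  adj⇔Adjacent = mk⇔
    (λ t → Sum.map ∈pentEdges⇒Edge ∈pentEdges⇒Edge (to (adj⇔∈edges (P′ n)) t))
    (λ e → from (adj⇔∈edges (P′ n)) (Sum.map Edge⇒∈pentEdges Edge⇒∈pentEdges e))

module ChainDistance (n : ℕ) (2≤n : 2 ≤ n) where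

  open Chain n public
  open Cycle L public

  W : ℕ
  W = 4 * n

  W≡M : W ≡ M
  W≡M = 4n≡2n+2n n
    where
    4n≡2n+2n : ∀ n → 4 * n ≡ 2 * n + 2 * n
    4n≡2n+2n = solve-∀

  -- Between cycle vertices a shortest path stays on the cycle or crosses one rung, giving
  -- h c = min(c, L + 1 − c); an odd vertex has no rung, so facing its antipode (c = L) it pays
  -- one more and goes through a w-vertex.  The vertex w_k is adjacent to the antipodal pair
  -- 2k + 1, L + 2k + 1, whence γ c = min(c, L − c) in the distances to w-vertices.
  γ : ℕ → ℕ
  γ = tent L

  h : ℕ → ℕ
  h = tent (suc L)

  penalty : Parity → ℕ → ℕ
  penalty 0ℙ c = 0
  penalty 1ℙ c = toℕ (c ≡ᵇ L)

  dUU : ℕ → ℕ → ℕ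
  dUU x y = h (cd x y) + penalty (parity x) (cd x y)

  dUW : ℕ → ℕ → ℕ
  dUW x k = suc (γ (cd x (2 * k + 1)))

  dWW : ℕ → ℕ → ℕ
  dWW k m = if k ≡ᵇ m then 0 else 2 + γ (cd (2 * k + 1) (2 * m + 1))

  D : ℕ → ℕ → ℕ
  D a b = if a <ᵇ W
          then (if b <ᵇ W then dUU a b else dUW a (b ∸ W))
          else (if b <ᵇ W then dUW b (a ∸ W) else dWW (a ∸ W) (b ∸ W))

  <W : ∀ {x} → x < M → (x <ᵇ W) ≡ true
  <W {x} x<M = <⇒<ᵇ≡true (subst (x <_) (sym W≡M) x<M)

  W+≮W : ∀ k → (W + k <ᵇ W) ≡ false
  W+≮W k = ≤⇒<ᵇ≡false (m≤m+n W k)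

  D-uu : ∀ {x y} → x < M → y < M → D x y ≡ dUU x y
  D-uu {x} {y} x<M y<M = trans (if-true (<W x<M)) (if-true (<W y<M))

  D-uw : ∀ {x} k → x < M → D x (W + k) ≡ dUW x k
  D-uw {x} k x<M = trans (if-true (<W x<M)) (trans (if-false (W+≮W k)) (cong (dUW x) (m+n∸m≡n W k)))

  D-wu : ∀ k {y} → y < M → D (W + k) y ≡ dUW y k
  D-wu k {y} y<M = trans (if-false (W+≮W k)) (trans (if-true (<W y<M)) (cong (dUW y) (m+n∸m≡n W k)))

  D-ww : ∀ k m → D (W + k) (W + m) ≡ dWW k m
  D-ww k m = trans (if-false (W+≮W k)) (trans (if-false (W+≮W m)) (cong₂ dWW (m+n∸m≡n W k) (m+n∸m≡n W m)))

  L≡n+n : L ≡ n + n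
  L≡n+n = cong (n +_) (+-identityʳ n)

  n<L : n < L
  n<L = subst (n <_) (sym L≡n+n) (m<m+n n (≤-trans (s≤s z≤n) 2≤n))

  0<L : 0 < L
  0<L = ≤-<-trans z≤n n<L

  2≤L : 2 ≤ L
  2≤L = ≤-trans 2≤n (<⇒≤ n<L)

  L<M : ∀ {x} → x < L → x < M
  L<M x<L = ≤-trans x<L (m≤m+n L L)

  2k<L : ∀ {k} → k < n → 2 * k < L
  2k<L k<n = *-monoʳ-< 2 k<n

  2k+1<L : ∀ {k} → k < n → 2 * k + 1 < L
  2k+1<L {k} k<n = subst (_≤ L) (2[1+k]≡2k+1+1 k) (*-monoʳ-≤ 2 k<n)
    where
    2[1+k]≡2k+1+1 : ∀ k → 2 * suc k ≡ suc (2 * k + 1)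
    2[1+k]≡2k+1+1 = solve-∀

  h-lower : ∀ {c} → c ≤ n → h c ≡ c
  h-lower c≤n = tent-≤ (≤-trans (+-mono-≤ c≤n c≤n) (≤-trans (≤-reflexive (sym L≡n+n)) (n≤1+n L)))

  h-upper : ∀ {c} → n < c → h c ≡ suc L ∸ c
  h-upper n<c = tent-≥ (≤-trans (≤-reflexive (cong suc L≡n+n)) (+-mono-≤ n<c (<⇒≤ n<c)))

  γ-lower : ∀ {c} → c ≤ n → γ c ≡ c
  γ-lower c≤n = tent-≤ (≤-trans (+-mono-≤ c≤n c≤n) (≤-reflexive (sym L≡n+n)))

  γ-upper : ∀ {c} → n ≤ c → γ c ≡ L ∸ c
  γ-upper n≤c = tent-≥ (≤-trans (≤-reflexive L≡n+n) (+-mono-≤ n≤c n≤c))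

  h-L : h L ≡ 1
  h-L = trans (h-upper n<L) (trans (+-∸-assoc 1 {L} ≤-refl) (cong suc (n∸n≡0 L)))

  γ≤h : ∀ c → γ c ≤ h c
  γ≤h c = ⊓-monoʳ-≤ c (∸-monoˡ-≤ c (n≤1+n L))

  h≤1+γ : ∀ c → h c ≤ suc (γ c)
  h≤1+γ c = ⊓-mono-≤ (n≤1+n c) (∸-near (suc L) {c} {suc c} ≤-refl)

  data Half : ℕ → Set where
    ev : ∀ {k} → k < n → Half (2 * k)
    od : ∀ {k} → k < n → Half (2 * k + 1)

  half : ∀ {y} → y < L → Half y
  half {y} y<L with even-or-odd y
  ... | k , inj₁ refl = ev (*-cancelˡ-< 2 k n y<L)
  ... | k , inj₂ refl = od (*-cancelˡ-< 2 k n (≤-<-trans (m≤m+n (2 * k) 1) y<L))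

  data Position : ℕ → Set where
    front : ∀ {y} → Half y → Position y
    back  : ∀ {y} → Half y → Position (L + y)

  position : ∀ {x} → x < M → Position x
  position {x} x<M with x <? L
  ... | yes x<L = front (half x<L)
  ... | no  x≮L with y , refl ← m≤n⇒∃[o]m+o≡n (≮⇒≥ x≮L) = back (half (+-cancelˡ-< L y L x<M))

  data Vertex : ℕ → Set where
    onCycle : ∀ {x} → x < M → Vertex x
    spoke   : ∀ {k} → k < n → Vertex (W + k)

  vertex : ∀ {a} → a < 5 * n → Vertex a
  vertex {a} a<5n with a <? W
  ... | yes a<W = onCycle (subst (a <_) W≡M a<W)
  ... | no  a≮W with k , refl ← m≤n⇒∃[o]m+o≡n (≮⇒≥ a≮W) = spoke (+-cancelˡ-< W k n (subst (W + k <_) (5n≡W+n n) a<5n))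

  M≤5n : M ≤ 5 * n
  M≤5n = subst₂ _≤_ W≡M (sym (5n≡W+n n)) (m≤m+n W n)

  cycle<5n : ∀ {x} → x < M → x < 5 * n
  cycle<5n x<M = ≤-trans x<M M≤5n

  spoke<5n : ∀ {k} → k < n → W + k < 5 * n
  spoke<5n {k} k<n = subst (W + k <_) (sym (5n≡W+n n)) (+-monoʳ-< W k<n)

  Lipschitz : ℕ → ℕ → Set
  Lipschitz x x′ = ∀ {b} → b < 5 * n → Near (D x b) (D x′ b)

  Lipschitz-sym : ∀ {x x′} → Lipschitz x x′ → Lipschitz x′ x
  Lipschitz-sym lip b< = Near-sym (lip b<)

  lipschitz : ∀ {x x′} → (∀ {y} → y < M → Near (D x y) (D x′ y)) →
              (∀ {m} → m < n → Near (D x (W + m)) (D x′ (W + m))) → Lipschitz x x′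
  lipschitz onCycle′ onSpoke b< with vertex b<
  ... | onCycle y<M = onCycle′ y<M
  ... | spoke m<n   = onSpoke m<n

  cd-antipode : ∀ {t y} → t < L → y < M → cd (L + t) y ≡ L ∸ cd t y
  cd-antipode {t} {y} t<L y<M = sym (trans (cong (_∸ cd t y) (sym (cd-antipodal t<L y<M))) (m+n∸n≡m _ (cd t y)))

  γ-antipode : ∀ {t y} → t < L → y < M → γ (cd (L + t) y) ≡ γ (cd t y)
  γ-antipode {t} {y} t<L y<M = trans (cong γ (cd-antipode t<L y<M)) (tent-reflect (cd≤L t y))

  1≤h : ∀ {c} → 1 ≤ c → c ≤ L → 1 ≤ h c
  1≤h 1≤c c≤L = ⊓-glb 1≤c (m+n≤o⇒m≤o∸n 1 (s≤s c≤L))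

  h-near : ∀ {c c′} → Near c c′ → h c ≤ suc (h c′)
  h-near nr = proj₁ (tent-near (suc L) nr)

  dUU-near : ∀ p {c c′} → Near c c′ → c′ ≤ L → h c + penalty p c ≤ suc (h c′ + penalty (p ⁻¹) c′)
  dUU-near 0ℙ {c} nr _ = ≤-trans (≤-reflexive (+-identityʳ (h c))) (≤-trans (h-near nr) (s≤s (m≤m+n _ _)))
  dUU-near 1ℙ {c} {c′} nr c′≤L with c ≡ᵇ L in eq
  ... | false = ≤-trans (≤-reflexive (+-identityʳ (h c))) (≤-trans (h-near nr) (s≤s (m≤m+n _ _)))
  ... | true with refl ← ≡ᵇ⇒≡ c L (subst T (sym eq) _) =
    ≤-trans (≤-reflexive (cong (_+ 1) h-L)) (s≤s (≤-trans (1≤h 1≤c′ c′≤L) (m≤m+n _ _)))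
    where
    1≤c′ : 1 ≤ c′
    1≤c′ = ≤-pred (≤-trans 2≤L (proj₁ nr))

  parity-M∸1 : parity (M ∸ 1) ≡ 1ℙ
  parity-M∸1 = trans (sym (suc-homo-⁻¹ (M ∸ 1))) (cong _⁻¹ (trans (cong parity M∸1+1≡M) parity-M))
    where
    parity-M : parity M ≡ 0ℙ
    parity-M = trans (parity-2*+ n L) (parity-2* n)
    M∸1+1≡M : suc (M ∸ 1) ≡ M
    M∸1+1≡M = trans (+-comm 1 (M ∸ 1)) (m∸n+n≡m (≤-trans 0<L (m≤m+n L L)))

  Next-parity : ∀ {x x′} → Next x x′ → parity x′ ≡ parity x ⁻¹
  Next-parity (next {x} _) = parity-suc x
  Next-parity wrap         = cong _⁻¹ (sym parity-M∸1)

  Step-parity : ∀ {x x′} → Step x x′ → parity x′ ≡ parity x ⁻¹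
  Step-parity (inj₁ nx) = Next-parity nx
  Step-parity (inj₂ nx) = sym (⁻¹-selfInverse (sym (Next-parity nx)))

  lipschitz-Step : ∀ {x x′} → x < M → Step x x′ → Lipschitz x x′
  lipschitz-Step {x} {x′} x<M step = lipschitz onCycle′ onSpoke
    where
    x′<M = Step-< x<M step
    onCycle′ : ∀ {y} → y < M → Near (D x y) (D x′ y)
    onCycle′ {y} y<M rewrite D-uu x<M y<M | D-uu x′<M y<M =
        subst (λ p → dUU x y ≤ suc (h (cd x′ y) + penalty p (cd x′ y))) (sym (Step-parity step))
          (dUU-near (parity x) (cd-Step step y<M) (cd≤L x′ y))
      , subst (λ p → dUU x′ y ≤ suc (h (cd x y) + penalty p (cd x y))) (⁻¹-selfInverse (sym (Step-parity step)))
          (dUU-near (parity x′) (Near-sym (cd-Step step y<M)) (cd≤L x y))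
    onSpoke : ∀ {m} → m < n → Near (D x (W + m)) (D x′ (W + m))
    onSpoke {m} m<n rewrite D-uw m x<M | D-uw m x′<M =
      let near = tent-near L (cd-Step step (L<M (2k+1<L m<n))) in s≤s (proj₁ near) , s≤s (proj₂ near)

  h-reflect-near : ∀ {c} → c ≤ L → Near (h c) (h (L ∸ c))
  h-reflect-near {c} c≤L rewrite +-∸-assoc 1 c≤L | +-∸-assoc 1 (m∸n≤m L c) | m∸[m∸n]≡n c≤L =
      subst (c ⊓ suc (L ∸ c) ≤_) (cong suc (⊓-comm (suc c) (L ∸ c)))
        (⊓-mono-≤ (m≤n⇒m≤1+n (n≤1+n c)) ≤-refl)
    , subst ((L ∸ c) ⊓ suc c ≤_) (cong suc (⊓-comm (suc (L ∸ c)) c))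
        (⊓-mono-≤ (m≤n⇒m≤1+n (n≤1+n _)) ≤-refl)

  lipschitz-rung : ∀ {k} → k < n → Lipschitz (2 * k) (L + 2 * k)
  lipschitz-rung {k} k<n = lipschitz onCycle′ onSpoke
    where
    x<L = 2k<L k<n
    x′<M = +-monoʳ-< L x<L
    onCycle′ : ∀ {y} → y < M → Near (D (2 * k) y) (D (L + 2 * k) y)
    onCycle′ {y} y<M rewrite D-uu (L<M x<L) y<M | D-uu x′<M y<M | parity-2* k | parity-2*+ n (2 * k) | parity-2* k
      | cd-antipode x<L y<M | +-identityʳ (h (cd (2 * k) y)) | +-identityʳ (h (L ∸ cd (2 * k) y)) =
      h-reflect-near (cd≤L (2 * k) y)
    onSpoke : ∀ {m} → m < n → Near (D (2 * k) (W + m)) (D (L + 2 * k) (W + m))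
    onSpoke {m} m<n rewrite D-uw m (L<M x<L) | D-uw m x′<M | γ-antipode x<L (L<M (2k+1<L m<n)) = Near-refl

  penalty≤1 : ∀ p c → penalty p c ≤ 1
  penalty≤1 0ℙ c = z≤n
  penalty≤1 1ℙ c with c ≡ᵇ L
  ... | true  = ≤-refl
  ... | false = z≤n

  lipschitz-spoke : ∀ {x k} → x < M → k < n → (∀ {y} → y < M → γ (cd x y) ≡ γ (cd (2 * k + 1) y)) →
                    Lipschitz x (W + k)
  lipschitz-spoke {x} {k} x<M k<n γ≡ = lipschitz onCycle′ onSpoke
    where
    onCycle′ : ∀ {y} → y < M → Near (D x y) (D (W + k) y)
    onCycle′ {y} y<M rewrite D-uu x<M y<M | D-wu k y<M | cd-sym y (2 * k + 1) | sym (γ≡ y<M) =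
        ≤-trans (+-mono-≤ (h≤1+γ (cd x y)) (penalty≤1 (parity x) (cd x y))) (≤-reflexive (+-comm (suc (γ (cd x y))) 1))
      , s≤s (≤-trans (γ≤h (cd x y)) (m≤m+n _ _))
    onSpoke : ∀ {m} → m < n → Near (D x (W + m)) (D (W + k) (W + m))
    onSpoke {m} m<n rewrite D-uw m x<M | D-ww k m | γ≡ (L<M (2k+1<L m<n)) with k ≡ᵇ m in eq
    ... | false = m≤n⇒m≤1+n (n≤1+n _) , ≤-refl
    ... | true with refl ← ≡ᵇ⇒≡ k m (subst T (sym eq) _) rewrite cd-self (2 * k + 1) = ≤-refl , z≤n

  suc[L∸1]≡L : suc (L ∸ 1) ≡ L
  suc[L∸1]≡L = trans (+-comm 1 (L ∸ 1)) (m∸n+n≡m 0<L)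

  L+[L∸1]≡M∸1 : L + (L ∸ 1) ≡ M ∸ 1
  L+[L∸1]≡M∸1 = sym (+-∸-assoc L 0<L)

  path<L : ∀ {i} → i < L ∸ 1 → suc i < L
  path<L {i} i< = subst (suc i <_) suc[L∸1]≡L (s≤s i<)

  L∸1<L : L ∸ 1 < L
  L∸1<L = subst (L ∸ 1 <_) suc[L∸1]≡L ≤-refl

  lipschitz-next : ∀ {x} → suc x < M → Lipschitz x (suc x)
  lipschitz-next x+1<M = lipschitz-Step (<⇒≤ x+1<M) (inj₁ (next x+1<M))

  Edge-lipschitz : ∀ {x x′} → Edge x x′ → Lipschitz x x′
  Edge-lipschitz (uu i<) = lipschitz-next (L<M (path<L i<))
  Edge-lipschitz (u′u′ {i} i<) = subst (Lipschitz (L + i)) (sym (+-suc L i))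
    (lipschitz-next (subst (_< M) (+-suc L i) (+-monoʳ-< L (path<L i<))))
  Edge-lipschitz uu′ = subst (Lipschitz (L ∸ 1)) (trans suc[L∸1]≡L (sym (+-identityʳ L)))
    (lipschitz-next (subst (_< M) (sym suc[L∸1]≡L) (m<m+n L 0<L)))
  Edge-lipschitz u′u = subst (λ z → Lipschitz z 0) (sym L+[L∸1]≡M∸1)
    (lipschitz-Step (subst (_< M) L+[L∸1]≡M∸1 (+-monoʳ-< L L∸1<L)) (inj₁ wrap))
  Edge-lipschitz (rung k<n) = lipschitz-rung k<n
  Edge-lipschitz (uw k<n) = lipschitz-spoke (L<M (2k+1<L k<n)) k<n (λ _ → refl)
  Edge-lipschitz (wu′ k<n) = Lipschitz-sym (lipschitz-spoke (+-monoʳ-< L (2k+1<L k<n)) k<n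
    (λ y<M → γ-antipode (2k+1<L k<n) y<M))

  Next⇒Edge : ∀ {x x′} → Next x x′ → Edge x x′
  Next⇒Edge wrap = subst (λ z → Edge z 0) L+[L∸1]≡M∸1 u′u
  Next⇒Edge (next {x} x+1<M) with <-cmp (suc x) L
  ... | tri< x+1<L _ _ = uu (≤-pred (subst (suc x <_) (sym suc[L∸1]≡L) x+1<L))
  ... | tri≈ _ x+1≡L _ =
    subst₂ Edge (cong pred (trans suc[L∸1]≡L (sym x+1≡L))) (trans (+-identityʳ L) (sym x+1≡L)) uu′
  ... | tri> _ _ L<x+1 with i , refl ← m≤n⇒∃[o]m+o≡n (≤-pred L<x+1) =
    subst (Edge (L + i)) (+-suc L i) (u′u′ (≤-pred (subst (suc (suc i) ≤_) (sym suc[L∸1]≡L) i+1<L)))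
    where
    i+1<L : suc i < L
    i+1<L = +-cancelˡ-< L (suc i) L (subst (_< M) (sym (+-suc L i)) x+1<M)

  Step⇒Adjacent : ∀ {x x′} → Step x x′ → Adjacent x x′
  Step⇒Adjacent (inj₁ nx) = inj₁ (Next⇒Edge nx)
  Step⇒Adjacent (inj₂ nx) = inj₂ (Next⇒Edge nx)

  Approach : ℕ → ℕ → Set
  Approach a b = ∃[ c ] c < 5 * n × Adjacent a c × suc (D c b) ≡ D a b

  penalty-< : ∀ p {c} → c < L → penalty p c ≡ 0
  penalty-< 0ℙ     c<L = refl
  penalty-< 1ℙ {c} c<L with c ≡ᵇ L in eq
  ... | false = refl
  ... | true  = ⊥-elim (<-irrefl (≡ᵇ⇒≡ c L (subst T (sym eq) _)) c<L)

  dUU-lower : ∀ x y → cd x y ≤ n → dUU x y ≡ cd x y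
  dUU-lower x y c≤n = trans (cong₂ _+_ (h-lower c≤n) (penalty-< (parity x) (≤-<-trans c≤n n<L))) (+-identityʳ _)

  dUU-even : ∀ x y → parity x ≡ 0ℙ → dUU x y ≡ h (cd x y)
  dUU-even x y even rewrite even = +-identityʳ _

  approach-near : ∀ {x y} → x < M → y < M → x ≢ y → cd x y ≤ n → Approach x y
  approach-near {x} {y} x<M y<M x≢y c≤n with x′ , step , closer ← cd-descent x<M y<M x≢y =
    x′ , cycle<5n x′<M , Step⇒Adjacent step , (begin
      suc (D x′ y)     ≡⟨ cong suc (trans (D-uu x′<M y<M) (dUU-lower x′ y c′≤n)) ⟩
      suc (cd x′ y)    ≡⟨ closer ⟩
      cd x y           ≡⟨ trans (D-uu x<M y<M) (dUU-lower x y c≤n) ⟨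
      D x y            ∎)
    where
    open ≡-Reasoning
    x′<M = Step-< x<M step
    c′≤n = ≤-trans (≤-trans (n≤1+n _) (≤-reflexive closer)) c≤n

  cd-antipode′ : ∀ {t y} → t < L → y < M → cd t y ≡ L ∸ cd (L + t) y
  cd-antipode′ {t} {y} t<L y<M = sym (trans (cong (_∸ cd (L + t) y) (sym (cd-antipodal t<L y<M))) (m+n∸m≡n (cd (L + t) y) (cd t y)))

  parity-L+ : ∀ x → parity (L + x) ≡ parity x
  parity-L+ = parity-2*+ n

  0ℙ≢1ℙ : 0ℙ ≢ 1ℙ
  0ℙ≢1ℙ ()

  rungPartner : ∀ {x} → x < M → parity x ≡ 0ℙ →
    ∃[ p ] p < M × Adjacent x p × parity p ≡ 0ℙ × (∀ {y} → y < M → cd p y ≡ L ∸ cd x y)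
  rungPartner x<M even with position x<M
  ... | front (ev {k} k<n) = L + 2 * k , +-monoʳ-< L (2k<L k<n) , inj₁ (rung k<n) ,
                             trans (parity-L+ (2 * k)) (parity-2* k) , cd-antipode (2k<L k<n)
  ... | back (ev {k} k<n)  = 2 * k , L<M (2k<L k<n) , inj₂ (rung k<n) , parity-2* k , cd-antipode′ (2k<L k<n)
  ... | front (od {k} k<n) = ⊥-elim (0ℙ≢1ℙ (trans (sym even) (parity-2*+1 k)))
  ... | back (od {k} k<n)  = ⊥-elim (0ℙ≢1ℙ (trans (sym even) (trans (parity-L+ (2 * k + 1)) (parity-2*+1 k))))

  spokeOf : ∀ {x} → x < M → parity x ≡ 1ℙ →
    ∃[ k ] k < n × Adjacent x (W + k) × (∀ {y} → y < M → γ (cd x y) ≡ γ (cd (2 * k + 1) y))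
  spokeOf x<M odd with position x<M
  ... | front (od {k} k<n) = k , k<n , inj₁ (uw k<n) , λ _ → refl
  ... | back (od {k} k<n)  = k , k<n , inj₂ (wu′ k<n) , γ-antipode (2k+1<L k<n)
  ... | front (ev {k} k<n) = ⊥-elim (0ℙ≢1ℙ (trans (sym (parity-2* k)) odd))
  ... | back (ev {k} k<n)  = ⊥-elim (0ℙ≢1ℙ (trans (sym (trans (parity-L+ (2 * k)) (parity-2* k))) odd))

  L∸c≤n : ∀ {c} → n < c → L ∸ c ≤ n
  L∸c≤n {c} n<c = m≤n+o⇒m∸n≤o L c (≤-trans (≤-reflexive L≡n+n) (+-monoˡ-≤ n (<⇒≤ n<c)))

  h-upper′ : ∀ {c} → n < c → c ≤ L → h c ≡ suc (L ∸ c)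
  h-upper′ n<c c≤L = trans (h-upper n<c) (+-∸-assoc 1 c≤L)

  approach-far-even : ∀ {x y} → x < M → y < M → parity x ≡ 0ℙ → n < cd x y → Approach x y
  approach-far-even {x} {y} x<M y<M even n<c
    with p , p<M , x~p , evenp , cdp ← rungPartner x<M even =
    p , cycle<5n p<M , x~p , (begin
      suc (D p y)          ≡⟨ cong suc (trans (D-uu p<M y<M) (dUU-even p y evenp)) ⟩
      suc (h (cd p y))     ≡⟨ cong (suc ∘ h) (cdp y<M) ⟩
      suc (h (L ∸ cd x y)) ≡⟨ cong suc (h-lower (L∸c≤n n<c)) ⟩
      suc (L ∸ cd x y)     ≡⟨ h-upper′ n<c (cd≤L x y) ⟨
      h (cd x y)           ≡⟨ trans (D-uu x<M y<M) (dUU-even x y even) ⟨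
      D x y                ∎)
    where open ≡-Reasoning

  dUU-< : ∀ x y → cd x y < L → dUU x y ≡ h (cd x y)
  dUU-< x y c<L = trans (cong (h (cd x y) +_) (penalty-< (parity x) c<L)) (+-identityʳ _)

  approach-far-odd : ∀ {x y} → x < M → y < M → parity x ≡ 1ℙ → n < cd x y → cd x y < L → Approach x y
  approach-far-odd {x} {y} x<M y<M odd n<c c<L with x′ , step , farther ← cd-ascent x<M y<M c<L =
    x′ , cycle<5n x′<M , Step⇒Adjacent step , (begin
      suc (D x′ y)                 ≡⟨ cong suc (trans (D-uu x′<M y<M) (dUU-even x′ y even′)) ⟩
      suc (h (cd x′ y))            ≡⟨ cong (suc ∘ h) farther ⟩
      suc (h (suc (cd x y)))       ≡⟨ cong suc (h-upper′ (≤-trans n<c (n≤1+n _)) c<L) ⟩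
      suc (suc (L ∸ suc (cd x y))) ≡⟨ cong suc (+-∸-assoc 1 c<L) ⟨
      suc (L ∸ cd x y)             ≡⟨ h-upper′ n<c (cd≤L x y) ⟨
      h (cd x y)                   ≡⟨ trans (D-uu x<M y<M) (dUU-< x y c<L) ⟨
      D x y                        ∎)
    where
    open ≡-Reasoning
    x′<M = Step-< x<M step
    even′ : parity x′ ≡ 0ℙ
    even′ = trans (Step-parity step) (cong _⁻¹ odd)

  approach-antipodal-odd : ∀ {x y} → x < M → y < M → parity x ≡ 1ℙ → cd x y ≡ L → Approach x y
  approach-antipodal-odd {x} {y} x<M y<M odd c≡L with k , k<n , x~w , γ≡ ← spokeOf x<M odd =
    W + k , spoke<5n k<n , x~w , (begin
      suc (D (W + k) y)                   ≡⟨ cong suc (D-wu k y<M) ⟩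
      suc (suc (γ (cd y (2 * k + 1))))    ≡⟨ cong (λ c → suc (suc (γ c))) (cd-sym y (2 * k + 1)) ⟩
      suc (suc (γ (cd (2 * k + 1) y)))    ≡⟨ cong (λ c → suc (suc c)) (trans (sym (γ≡ y<M)) (trans (cong γ c≡L) (tent-K L))) ⟩
      2                                   ≡⟨ cong₂ _+_ h-L (cong toℕ (to T-≡ (≡⇒≡ᵇ L L refl))) ⟨
      h L + penalty 1ℙ L                  ≡⟨ cong (λ c → h c + penalty 1ℙ c) c≡L ⟨
      h (cd x y) + penalty 1ℙ (cd x y)    ≡⟨ trans (D-uu x<M y<M) (cong (λ p → h (cd x y) + penalty p (cd x y)) odd) ⟨
      D x y                               ∎)
    where open ≡-Reasoning

  approach-uu : ∀ {x y} → x < M → y < M → x ≢ y → Approach x y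
  approach-uu {x} {y} x<M y<M x≢y with cd x y ≤? n
  ... | yes c≤n = approach-near x<M y<M x≢y c≤n
  ... | no  c≰n with parity-cases x
  ...   | inj₁ even = approach-far-even x<M y<M even (≰⇒> c≰n)
  ...   | inj₂ odd with cd x y <? L
  ...     | yes c<L = approach-far-odd x<M y<M odd (≰⇒> c≰n) c<L
  ...     | no  c≮L = approach-antipodal-odd x<M y<M odd (≤-antisym (cd≤L x y) (≮⇒≥ c≮L))

  cd≡L⇒antipode : ∀ {x t} → x < M → t < L → cd x t ≡ L → x ≡ L + t
  cd≡L⇒antipode {x} {t} x<M t<L c≡L = sym (cd≡0⇒≡ (+-monoʳ-< L t<L) x<M (+-cancelʳ-≡ L (cd (L + t) x) 0 (begin
    cd (L + t) x + L      ≡⟨ cong (cd (L + t) x +_) (trans (sym c≡L) (cd-sym x t)) ⟩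
    cd (L + t) x + cd t x ≡⟨ cd-antipodal t<L x<M ⟩
    L                     ∎)))
    where open ≡-Reasoning

  γ-cd≡0 : ∀ {x t} → x < M → t < L → γ (cd x t) ≡ 0 → x ≡ t ⊎ x ≡ L + t
  γ-cd≡0 {x} {t} x<M t<L γ≡0 with tent≡0 (cd x t) γ≡0
  ... | inj₁ c≡0 = inj₁ (cd≡0⇒≡ x<M (L<M t<L) c≡0)
  ... | inj₂ L≤c = inj₂ (cd≡L⇒antipode x<M t<L (≤-antisym (cd≤L x t) L≤c))

  dWW-self : ∀ m → dWW m m ≡ 0
  dWW-self m rewrite to T-≡ (≡⇒≡ᵇ m m refl) = refl

  0<γ⇒≢ : ∀ {x t} → 0 < γ (cd x t) → x ≢ t
  0<γ⇒≢ {x} 0<γ refl = <-irrefl (sym (cong γ (cd-self x))) 0<γ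

  0<γ⇒cd<L : ∀ {x t} → 0 < γ (cd x t) → cd x t < L
  0<γ⇒cd<L {x} {t} 0<γ = ≤∧≢⇒< (cd≤L x t) (λ c≡L → <-irrefl (sym (trans (cong γ c≡L) (tent-K L))) 0<γ)

  γ-descent : ∀ {x t} → x < M → t < M → 0 < γ (cd x t) → ∃[ x′ ] Step x x′ × suc (γ (cd x′ t)) ≡ γ (cd x t)
  γ-descent {x} {t} x<M t<M 0<γ with cd x t ≤? n
  ... | yes c≤n with x′ , step , closer ← cd-descent x<M t<M (0<γ⇒≢ {x} {t} 0<γ) =
    x′ , step , (begin
      suc (γ (cd x′ t)) ≡⟨ cong suc (γ-lower (≤-trans (≤-trans (n≤1+n _) (≤-reflexive closer)) c≤n)) ⟩
      suc (cd x′ t)     ≡⟨ closer ⟩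
      cd x t            ≡⟨ γ-lower c≤n ⟨
      γ (cd x t)        ∎)
    where open ≡-Reasoning
  ... | no c≰n with x′ , step , farther ← cd-ascent x<M t<M (0<γ⇒cd<L {x} {t} 0<γ) =
    x′ , step , (begin
      suc (γ (cd x′ t))       ≡⟨ cong (suc ∘ γ) farther ⟩
      suc (γ (suc (cd x t)))  ≡⟨ cong suc (γ-upper (≤-trans (<⇒≤ (≰⇒> c≰n)) (n≤1+n _))) ⟩
      suc (L ∸ suc (cd x t))  ≡⟨ +-∸-assoc 1 (0<γ⇒cd<L {x} {t} 0<γ) ⟨
      L ∸ cd x t              ≡⟨ γ-upper (<⇒≤ (≰⇒> c≰n)) ⟨
      γ (cd x t)              ∎)
    where open ≡-Reasoning

  approach-uw : ∀ {x m} → x < M → m < n → Approach x (W + m)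
  approach-uw {x} {m} x<M m<n with γ (cd x (2 * m + 1)) ≟ 0
  ... | yes γ≡0 = W + m , spoke<5n m<n , adjacent (γ-cd≡0 x<M (2k+1<L m<n) γ≡0) ,
                  trans (cong suc (trans (D-ww m m) (dWW-self m))) (sym (trans (D-uw m x<M) (cong suc γ≡0)))
    where
    adjacent : x ≡ 2 * m + 1 ⊎ x ≡ L + (2 * m + 1) → Adjacent x (W + m)
    adjacent (inj₁ refl) = inj₁ (uw m<n)
    adjacent (inj₂ refl) = inj₂ (wu′ m<n)
  ... | no  γ≢0 with x′ , step , closer ← γ-descent x<M (L<M (2k+1<L m<n)) (n≢0⇒n>0 γ≢0) =
    x′ , cycle<5n (Step-< x<M step) , Step⇒Adjacent step ,
    trans (cong suc (D-uw m (Step-< x<M step))) (trans (cong suc closer) (sym (D-uw m x<M)))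

  approach-wu : ∀ {k y} → k < n → y < M → Approach (W + k) y
  approach-wu {k} {y} k<n y<M with cd (2 * k + 1) y ≤? n
  ... | yes c≤n = 2 * k + 1 , cycle<5n t<M , inj₂ (uw k<n) , (begin
      suc (D (2 * k + 1) y)             ≡⟨ cong suc (trans (D-uu t<M y<M) (dUU-lower (2 * k + 1) y c≤n)) ⟩
      suc (cd (2 * k + 1) y)            ≡⟨ cong suc (γ-lower c≤n) ⟨
      suc (γ (cd (2 * k + 1) y))        ≡⟨ trans (D-wu k y<M) (cong (suc ∘ γ) (cd-sym y (2 * k + 1))) ⟨
      D (W + k) y                       ∎)
    where
    open ≡-Reasoning
    t<M = L<M (2k+1<L k<n)
  ... | no  c≰n = L + (2 * k + 1) , cycle<5n t′<M , inj₁ (wu′ k<n) , (begin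
      suc (D (L + (2 * k + 1)) y)       ≡⟨ cong suc (trans (D-uu t′<M y<M) (dUU-lower (L + (2 * k + 1)) y c′≤n)) ⟩
      suc (cd (L + (2 * k + 1)) y)      ≡⟨ cong suc (cd-antipode (2k+1<L k<n) y<M) ⟩
      suc (L ∸ cd (2 * k + 1) y)        ≡⟨ cong suc (γ-upper (<⇒≤ (≰⇒> c≰n))) ⟨
      suc (γ (cd (2 * k + 1) y))        ≡⟨ trans (D-wu k y<M) (cong (suc ∘ γ) (cd-sym y (2 * k + 1))) ⟨
      D (W + k) y                       ∎)
    where
    open ≡-Reasoning
    t′<M = +-monoʳ-< L (2k+1<L k<n)
    c′≤n : cd (L + (2 * k + 1)) y ≤ n
    c′≤n = subst (_≤ n) (sym (cd-antipode (2k+1<L k<n) y<M)) (L∸c≤n (≰⇒> c≰n))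

  dWW-≢ : ∀ {k m} → k ≢ m → dWW k m ≡ 2 + γ (cd (2 * k + 1) (2 * m + 1))
  dWW-≢ {k} {m} k≢m with k ≡ᵇ m in eq
  ... | false = refl
  ... | true  = ⊥-elim (k≢m (≡ᵇ⇒≡ k m (subst T (sym eq) _)))

  approach-ww : ∀ {k m} → k < n → k ≢ m → Approach (W + k) (W + m)
  approach-ww {k} {m} k<n k≢m = 2 * k + 1 , cycle<5n t<M , inj₂ (uw k<n) ,
    trans (cong suc (D-uw m t<M)) (sym (trans (D-ww k m) (dWW-≢ k≢m)))
    where
    t<M = L<M (2k+1<L k<n)

  approach : ∀ {a b} → a < 5 * n → b < 5 * n → a ≢ b → Approach a b
  approach a< b< a≢b with vertex a< | vertex b<
  ... | onCycle x<M | onCycle y<M = approach-uu x<M y<M a≢b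
  ... | onCycle x<M | spoke m<n   = approach-uw x<M m<n
  ... | spoke k<n   | onCycle y<M = approach-wu k<n y<M
  ... | spoke k<n   | spoke m<n   = approach-ww k<n (λ k≡m → a≢b (cong (W +_) k≡m))

  D-refl : ∀ {a} → a < 5 * n → D a a ≡ 0
  D-refl a< with vertex a<
  ... | onCycle {x} x<M = trans (D-uu x<M x<M) (trans (dUU-< x x (subst (_< L) (sym (cd-self x)) 0<L)) (cong h (cd-self x)))
  ... | spoke {k} _     = trans (D-ww k k) (dWW-self k)

  D≡0⇒≡ : ∀ {a b} → a < 5 * n → b < 5 * n → D a b ≡ 0 → a ≡ b
  D≡0⇒≡ a< b< D≡0 with vertex a< | vertex b<
  ... | onCycle {x} x<M | onCycle {y} y<M = cd≡0⇒≡ x<M y<M (≤-antisym (≮⇒≥ cd≮1) z≤n)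
    where
    cd≮1 : ¬ 1 ≤ cd x y
    cd≮1 1≤c = <-irrefl (sym (m+n≡0⇒m≡0 _ (trans (sym (D-uu x<M y<M)) D≡0))) (1≤h 1≤c (cd≤L x y))
  ... | onCycle x<M | spoke {m} _     = ⊥-elim (1+n≢0 (trans (sym (D-uw m x<M)) D≡0))
  ... | spoke {k} _ | onCycle y<M     = ⊥-elim (1+n≢0 (trans (sym (D-wu k y<M)) D≡0))
  ... | spoke {k} _ | spoke {m} _ with k ≟ m
  ...   | yes refl = refl
  ...   | no  k≢m  = ⊥-elim (1+n≢0 (trans (sym (trans (D-ww k m) (dWW-≢ k≢m))) D≡0))

  D-edge : ∀ {a c b} → T (adj (P′ n) a c) → b < 5 * n → D a b ≤ suc (D c b)
  D-edge ac b< with to adj⇔Adjacent ac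
  ... | inj₁ edge = proj₁ (Edge-lipschitz edge b<)
  ... | inj₂ edge = proj₂ (Edge-lipschitz edge b<)

  D-bounded : ∀ {a b} → a < 5 * n → b < 5 * n → D a b ≤ 5 * n
  D-bounded a< b< = ≤-trans (≤2+L (vertex a<) (vertex b<)) 2+L≤5n
    where
    2+L≤5n : 2 + L ≤ 5 * n
    2+L≤5n = subst (2 + L ≤_) (sym (5n≡n+2n+2n n)) (+-monoˡ-≤ L (≤-trans 2≤n (m≤m+n n (2 * n))))
      where
      5n≡n+2n+2n : ∀ n → 5 * n ≡ n + 2 * n + 2 * n
      5n≡n+2n+2n = solve-∀
    cd+2≤2+L : ∀ {c} x y → c ≤ cd x y + 2 → c ≤ 2 + L
    cd+2≤2+L x y c≤ = ≤-trans c≤ (≤-trans (≤-reflexive (+-comm _ 2)) (+-monoʳ-≤ 2 (cd≤L x y)))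
    ≤2+L : ∀ {a b} → Vertex a → Vertex b → D a b ≤ 2 + L
    ≤2+L (onCycle {x} x<M) (onCycle {y} y<M) rewrite D-uu x<M y<M = cd+2≤2+L x y
      (+-mono-≤ (m⊓n≤m (cd x y) _) (≤-trans (penalty≤1 (parity x) (cd x y)) (n≤1+n 1)))
    ≤2+L (onCycle {x} x<M) (spoke {m} _) rewrite D-uw m x<M = cd+2≤2+L x (2 * m + 1)
      (≤-trans (s≤s (m⊓n≤m _ _)) (≤-trans (≤-reflexive (+-comm 1 _)) (+-monoʳ-≤ (cd x (2 * m + 1)) (n≤1+n 1))))
    ≤2+L (spoke {k} _) (onCycle {y} y<M) rewrite D-wu k y<M = cd+2≤2+L y (2 * k + 1)
      (≤-trans (s≤s (m⊓n≤m _ _)) (≤-trans (≤-reflexive (+-comm 1 _)) (+-monoʳ-≤ (cd y (2 * k + 1)) (n≤1+n 1))))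
    ≤2+L (spoke {k} _) (spoke {m} _) rewrite D-ww k m with k ≡ᵇ m
    ... | true  = z≤n
    ... | false = s≤s (s≤s (≤-trans (m⊓n≤m _ _) (cd≤L (2 * k + 1) (2 * m + 1))))

  Edge⇒≢ : ∀ {x y} → Edge x y → x ≢ y
  Edge⇒≢ (uu _)      eq = 1+n≢n (sym eq)
  Edge⇒≢ (u′u′ {i} _) eq = 1+n≢n (sym (+-cancelˡ-≡ L i (suc i) eq))
  Edge⇒≢ uu′          eq = <-irrefl (trans eq (+-identityʳ L)) L∸1<L
  Edge⇒≢ u′u          eq = <-irrefl (sym eq) (≤-trans 0<L (m≤m+n L _))
  Edge⇒≢ (rung {k} _) eq = <-irrefl eq (m<n+m (2 * k) 0<L)
  Edge⇒≢ (uw {k} k<n) eq = <-irrefl eq (≤-trans (L<M (2k+1<L k<n)) (≤-trans (≤-reflexive (sym W≡M)) (m≤m+n W k)))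
  Edge⇒≢ (wu′ {k} k<n) eq = <-irrefl (sym eq)
    (≤-trans (+-monoʳ-< L (2k+1<L k<n)) (≤-trans (≤-reflexive (sym W≡M)) (m≤m+n W k)))

  loopless : ∀ a → ¬ T (adj (P′ n) a a)
  loopless a aa with to adj⇔Adjacent aa
  ... | inj₁ edge = Edge⇒≢ edge refl
  ... | inj₂ edge = Edge⇒≢ edge refl

  D-descent : ∀ {a b} → a < 5 * n → b < 5 * n → a ≢ b → ∃[ c ] c < 5 * n × T (adj (P′ n) a c) × suc (D c b) ≡ D a b
  D-descent a< b< a≢b with c , c< , a~c , step ← approach a< b< a≢b = c , c< , from adj⇔Adjacent a~c , step

  open DistanceCertificate (P′ n) D D-refl D≡0⇒≡ D-edge D-descent D-bounded public

chainPolynomial : ℕ → ℕ → ℕ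
chainPolynomial n s = 96 * (n * n * n) + 128 * (n * n) + 18 * n + 8 * n * s

chainPolynomial-blocks : ∀ n s →
  9 * ((2 * n + 2 * n) * (2 * (n * n + n)) + 2 * n) + 6 * (n * (2 * (2 * n) + 2 * (n * n)))
  + 6 * (n * (2 * (2 * n) + 2 * (n * n))) + 4 * (n * (2 * n + 2 * s))
  ≡ 96 * (n * n * n) + 128 * (n * n) + 18 * n + 8 * n * s
chainPolynomial-blocks = solve-∀

module ChainSums (n : ℕ) (2≤n : 2 ≤ n) where

  open ChainDistance n 2≤n public

  Σ<-vertices : ∀ (f : ℕ → ℕ) → Σ< (5 * n) f ≡ Σ< M f + Σ< n (λ k → f (W + k))
  Σ<-vertices f = trans (cong (λ K → Σ< K f) (5n≡W+n n))
                        (trans (Σ<-split W n f) (cong (λ K → Σ< K f + Σ< n (λ k → f (W + k))) W≡M))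

  deg-split : ∀ {a} → a < 5 * n → deg (P′ n) a ≡ Σ< M (λ y → toℕ (D a y ≡ᵇ 1)) + Σ< n (λ m → toℕ (D a (W + m) ≡ᵇ 1))
  deg-split a< = trans (deg≡#D≡1 loopless a<) (Σ<-vertices _)

  γ-cd≡0⇒≡ : ∀ {r t} → r < L → t < L → T (γ (cd r t) ≡ᵇ 0) → r ≡ t
  γ-cd≡0⇒≡ {r} {t} r<L t<L γ≡0 with γ-cd≡0 (L<M r<L) t<L (≡ᵇ⇒≡ _ 0 γ≡0)
  ... | inj₁ r≡t  = r≡t
  ... | inj₂ r≡L+t = ⊥-elim (<-irrefl r≡L+t (≤-trans r<L (m≤m+n L t)))

  #spokeNeighbours : ∀ {r} → r < L → Σ< n (λ m → toℕ (γ (cd r (2 * m + 1)) ≡ᵇ 0)) ≡ oddness (parity r)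
  #spokeNeighbours r<L with half r<L
  ... | ev {k} k<n = trans (Σ<-none n _ (λ {m} m<n γ≡0 → 0ℙ≢1ℙ (trans (sym (parity-2* k))
                       (trans (cong parity (γ-cd≡0⇒≡ r<L (2k+1<L m<n) γ≡0)) (parity-2*+1 m)))))
                       (cong oddness (sym (parity-2* k)))
  ... | od {k} k<n = trans (Σ<-unique n _ k<n (≡⇒≡ᵇ (γ (cd t t)) 0 (cong γ (cd-self t)))
                       (λ {m} m<n γ≡0 → sym (2*+1-injective (γ-cd≡0⇒≡ r<L (2k+1<L m<n) γ≡0))))
                       (cong oddness (sym (parity-2*+1 k)))
    where
    t = 2 * k + 1
    2*+1-injective : ∀ {k m} → 2 * k + 1 ≡ 2 * m + 1 → k ≡ m
    2*+1-injective {k} {m} eq = *-cancelˡ-≡ k m 2 (+-cancelʳ-≡ 1 (2 * k) (2 * m) eq)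

  penalty-L : ∀ p → penalty p L ≡ oddness p
  penalty-L 0ℙ = refl
  penalty-L 1ℙ = cong toℕ (to T-≡ (≡⇒≡ᵇ L L refl))

  antipodal-fold : ∀ {x} → x < M → ∃[ r ] r < L × parity x ≡ parity r × (∀ {t} → t < M → γ (cd x t) ≡ γ (cd r t))
  antipodal-fold {x} x<M with x <? L
  ... | yes x<L = x , x<L , refl , λ _ → refl
  ... | no  x≮L with r , refl ← m≤n⇒∃[o]m+o≡n (≮⇒≥ x≮L) =
    r , r<L , parity-L+ r , γ-antipode r<L
    where r<L = +-cancelˡ-< L r L x<M

  #cycleNeighbours : ∀ {x} → x < M → Σ< M (λ y → toℕ (D x y ≡ᵇ 1)) ≡ 2 + toℕ (1 + oddness (parity x) ≡ᵇ 1)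
  #cycleNeighbours {x} x<M = begin
    Σ< M (λ y → toℕ (D x y ≡ᵇ 1))         ≡⟨ Σ<-cong M (λ y y<M → cong (λ d → toℕ (d ≡ᵇ 1)) (D-uu x<M y<M)) ⟩
    Σ< M (λ y → F (cd x y))               ≡⟨ Σ<-cd F x<M ⟩
    Σ< L F + Σ< L (F ∘ suc)               ≡⟨ Σ<-sparse L F 2≤L F≡0 ⟩
    F 0 + (F 1 + F 1) + F L               ≡⟨ cong₂ (λ a b → a + (b + b) + F L) F0 F1 ⟩
    2 + F L                               ≡⟨ cong (λ c → 2 + toℕ (c + penalty p L ≡ᵇ 1)) h-L ⟩
    2 + toℕ (1 + penalty p L ≡ᵇ 1)        ≡⟨ cong (λ c → 2 + toℕ (1 + c ≡ᵇ 1)) (penalty-L p) ⟩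
    2 + toℕ (1 + oddness p ≡ᵇ 1)          ∎
    where
    open ≡-Reasoning
    p = parity x
    F : ℕ → ℕ
    F c = toℕ (h c + penalty p c ≡ᵇ 1)
    F0 : F 0 ≡ 0
    F0 = cong (λ c → toℕ (c ≡ᵇ 1)) (penalty-< p 0<L)
    F1 : F 1 ≡ 1
    F1 = cong (λ c → toℕ (c ≡ᵇ 1)) (cong₂ _+_ (h-lower (≤-trans (s≤s z≤n) 2≤n)) (penalty-< p (≤-trans (s≤s (s≤s z≤n)) 2≤L)))
    F≡0 : ∀ {c} → 2 ≤ c → c < L → F c ≡ 0
    F≡0 {c} 2≤c c<L = toℕ-≡ᵇ (λ eq → <-irrefl (sym eq) (≤-trans 2≤h (m≤m+n (h c) _)))
      where
      2≤h : 2 ≤ h c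
      2≤h = ⊓-glb 2≤c (m+n≤o⇒m≤o∸n 2 (s≤s c<L))

  deg-cycle : ∀ {x} → x < M → deg (P′ n) x ≡ 3
  deg-cycle {x} x<M with r , r<L , parity≡ , γ≡ ← antipodal-fold x<M = begin
    deg (P′ n) x
      ≡⟨ deg-split (cycle<5n x<M) ⟩
    Σ< M (λ y → toℕ (D x y ≡ᵇ 1)) + Σ< n (λ m → toℕ (D x (W + m) ≡ᵇ 1))
      ≡⟨ cong₂ _+_ (#cycleNeighbours x<M) (Σ<-cong n (λ m m<n → cong (λ d → toℕ (d ≡ᵇ 1))
                     (trans (D-uw m x<M) (cong suc (γ≡ (L<M (2k+1<L m<n))))))) ⟩
    2 + toℕ (1 + oddness (parity x) ≡ᵇ 1) + Σ< n (λ m → toℕ (γ (cd r (2 * m + 1)) ≡ᵇ 0))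
      ≡⟨ cong (2 + toℕ (1 + oddness (parity x) ≡ᵇ 1) +_) (trans (#spokeNeighbours r<L) (cong oddness (sym parity≡))) ⟩
    2 + toℕ (1 + oddness (parity x) ≡ᵇ 1) + oddness (parity x)
      ≡⟨ degree-by-parity (parity x) ⟩
    3 ∎
    where
    open ≡-Reasoning
    degree-by-parity : ∀ p → 2 + toℕ (1 + oddness p ≡ᵇ 1) + oddness p ≡ 3
    degree-by-parity 0ℙ = refl
    degree-by-parity 1ℙ = refl

  γ≢0 : ∀ {c} → 0 < c → c < L → γ c ≢ 0
  γ≢0 {c} 0<c c<L γ≡0 with tent≡0 c γ≡0
  ... | inj₁ refl = <-irrefl refl 0<c
  ... | inj₂ L≤c  = <⇒≱ c<L L≤c

  deg-spoke : ∀ {k} → k < n → deg (P′ n) (W + k) ≡ 2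
  deg-spoke {k} k<n = begin
    deg (P′ n) (W + k)
      ≡⟨ deg-split (spoke<5n k<n) ⟩
    Σ< M (λ y → toℕ (D (W + k) y ≡ᵇ 1)) + Σ< n (λ m → toℕ (D (W + k) (W + m) ≡ᵇ 1))
      ≡⟨ cong₂ _+_ (Σ<-cong M (λ y y<M → cong (λ d → toℕ (d ≡ᵇ 1)) (trans (D-wu k y<M) (cong (suc ∘ γ) (cd-sym y t)))))
                   (Σ<-zero n (λ m _ → trans (cong (λ d → toℕ (d ≡ᵇ 1)) (D-ww k m)) (dWW≢1 m))) ⟩
    Σ< M (λ y → G (cd t y)) + 0
      ≡⟨ cong (_+ 0) (trans (Σ<-cd G t<M) (Σ<-sparse L G 2≤L G≡0)) ⟩
    G 0 + (G 1 + G 1) + G L + 0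
      ≡⟨ cong (λ g → 1 + (g + g) + G L + 0) G1 ⟩
    1 + G L + 0
      ≡⟨ cong (λ g → 1 + toℕ (g ≡ᵇ 0) + 0) (tent-K L) ⟩
    2 ∎
    where
    open ≡-Reasoning
    t = 2 * k + 1
    t<M = L<M (2k+1<L k<n)
    G : ℕ → ℕ
    G c = toℕ (γ c ≡ᵇ 0)
    G1 : G 1 ≡ 0
    G1 = cong (λ c → toℕ (c ≡ᵇ 0)) (γ-lower (≤-trans (s≤s z≤n) 2≤n))
    G≡0 : ∀ {c} → 2 ≤ c → c < L → G c ≡ 0
    G≡0 2≤c c<L = toℕ-≡ᵇ (γ≢0 (≤-trans (s≤s z≤n) 2≤c) c<L)
    dWW≢1 : ∀ m → toℕ (dWW k m ≡ᵇ 1) ≡ 0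
    dWW≢1 m with k ≡ᵇ m
    ... | true  = refl
    ... | false = refl

  Σ<-h : Σ< L h + Σ< L (h ∘ suc) + 1 ≡ 2 * (n * n + n)
  Σ<-h = begin
    Σ< L h + Σ< L (h ∘ suc) + 1         ≡⟨ regroup (Σ< L h) (Σ< L (h ∘ suc)) ⟩
    (Σ< L h + 1) + Σ< L (h ∘ suc)       ≡⟨ cong (λ c → Σ< L h + c + Σ< L (h ∘ suc)) h-L ⟨
    (Σ< L h + h L) + Σ< (suc L) h       ≡⟨ cong (_+ Σ< (suc L) h) (Σ<-last L h) ⟨
    Σ< (suc L) h + Σ< (suc L) h         ≡⟨ cong (λ K → Σ< (suc K) (tent (suc K)) + Σ< (suc K) (tent (suc K))) L≡n+n ⟩
    Σ< (suc (n + n)) (tent (suc (n + n))) + Σ< (suc (n + n)) (tent (suc (n + n)))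
                                        ≡⟨ cong₂ _+_ (Σ<-tent-odd n) (Σ<-tent-odd n) ⟩
    (n * n + n) + (n * n + n)           ≡⟨ cong ((n * n + n) +_) (+-identityʳ _) ⟨
    2 * (n * n + n)                     ∎
    where
    open ≡-Reasoning
    regroup : ∀ a b → a + b + 1 ≡ (a + 1) + b
    regroup = solve-∀

  Σ<-γ : Σ< L γ + Σ< L (γ ∘ suc) ≡ 2 * (n * n)
  Σ<-γ = begin
    Σ< L γ + Σ< L (γ ∘ suc)             ≡⟨ cong (Σ< L γ +_) (Σ<-last L γ) ⟩
    Σ< L γ + (Σ< L γ + γ L)             ≡⟨ cong (λ c → Σ< L γ + (Σ< L γ + c)) (tent-K L) ⟩
    Σ< L γ + (Σ< L γ + 0)               ≡⟨ cong (λ K → Σ< K (tent K) + (Σ< K (tent K) + 0)) L≡n+n ⟩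
    Σ< (n + n) (tent (n + n)) + (Σ< (n + n) (tent (n + n)) + 0)
                                        ≡⟨ cong (λ s → s + (s + 0)) (Σ<-tent-even n) ⟩
    2 * (n * n)                         ∎
    where open ≡-Reasoning

  -- Row sums carry their deficits on the left-hand side, so that no truncated subtraction occurs.
  row-uu : ∀ {x} → x < M → Σ< M (dUU x) + 1 ≡ 2 * (n * n + n) + oddness (parity x)
  row-uu {x} x<M = begin
    Σ< M (dUU x) + 1
      ≡⟨ cong (_+ 1) (Σ<-cd F x<M) ⟩
    Σ< L F + Σ< L (F ∘ suc) + 1
      ≡⟨ cong (_+ 1) (cong₂ _+_ (Σ<-+ L h (penalty p)) (Σ<-+ L (h ∘ suc) (penalty p ∘ suc))) ⟩
    (Σ< L h + Σ< L (penalty p)) + (Σ< L (h ∘ suc) + Σ< L (penalty p ∘ suc)) + 1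
      ≡⟨ regroup (Σ< L h) (Σ< L (penalty p)) (Σ< L (h ∘ suc)) (Σ< L (penalty p ∘ suc)) ⟩
    (Σ< L h + Σ< L (h ∘ suc) + 1) + (Σ< L (penalty p) + Σ< L (penalty p ∘ suc))
      ≡⟨ cong₂ _+_ Σ<-h (Σ<-sparse L (penalty p) 2≤L (λ _ c<L → penalty-< p c<L)) ⟩
    2 * (n * n + n) + (penalty p 0 + (penalty p 1 + penalty p 1) + penalty p L)
      ≡⟨ cong (λ s → 2 * (n * n + n) + s) pen-sum ⟩
    2 * (n * n + n) + oddness p
      ∎
    where
    open ≡-Reasoning
    p = parity x
    F : ℕ → ℕ
    F c = h c + penalty p c
    pen-sum : penalty p 0 + (penalty p 1 + penalty p 1) + penalty p L ≡ oddness p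
    pen-sum rewrite penalty-< p 0<L | penalty-< p (≤-trans (s≤s (s≤s z≤n)) 2≤L) = penalty-L p
    regroup : ∀ a b c d → (a + b) + (c + d) + 1 ≡ (a + c + 1) + (b + d)
    regroup = solve-∀

  row-uw : ∀ {m} → m < n → Σ< M (λ x → dUW x m) ≡ 2 * L + 2 * (n * n)
  row-uw {m} m<n = begin
    Σ< M (λ x → dUW x m)
      ≡⟨ Σ<-cong M (λ x _ → cong (suc ∘ γ) (cd-sym x t)) ⟩
    Σ< M (λ x → suc (γ (cd t x)))
      ≡⟨ Σ<-cd (suc ∘ γ) (L<M (2k+1<L m<n)) ⟩
    Σ< L (suc ∘ γ) + Σ< L (suc ∘ γ ∘ suc)
      ≡⟨ cong₂ _+_ (Σ<-+ L (λ _ → 1) γ) (Σ<-+ L (λ _ → 1) (γ ∘ suc)) ⟩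
    (Σ< L (λ _ → 1) + Σ< L γ) + (Σ< L (λ _ → 1) + Σ< L (γ ∘ suc))
      ≡⟨ cong (λ l → (l + Σ< L γ) + (l + Σ< L (γ ∘ suc))) (trans (Σ<-const L 1) (*-identityʳ L)) ⟩
    (L + Σ< L γ) + (L + Σ< L (γ ∘ suc))
      ≡⟨ +-interchange L (Σ< L γ) L (Σ< L (γ ∘ suc)) ⟩
    (L + L) + (Σ< L γ + Σ< L (γ ∘ suc))
      ≡⟨ cong₂ _+_ (cong (L +_) (sym (+-identityʳ L))) Σ<-γ ⟩
    2 * L + 2 * (n * n)
      ∎
    where
    open ≡-Reasoning
    t = 2 * m + 1

  spokeDist : ℕ → ℕ
  spokeDist zero    = 0
  spokeDist (suc e) = 2 + 2 * tent n (suc e)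

  spokeDist-pos : ∀ {e} → 0 < e → spokeDist e ≡ 2 + 2 * tent n e
  spokeDist-pos {suc e} _ = refl

  γ-cd-odd : ∀ {k m} → k < n → m < n → γ (cd (2 * k + 1) (2 * m + 1)) ≡ 2 * tent n ∣ k - m ∣
  γ-cd-odd {k} {m} k<n m<n = begin
    γ (tent M ∣ 2 * k + 1 - 2 * m + 1 ∣)   ≡⟨ cong (γ ∘ tent M) ∣odd-odd∣ ⟩
    γ (tent M (2 * ∣ k - m ∣))             ≡⟨ cong γ (tent-lower (*-monoʳ-≤ 2 (<⇒≤ ∣k-m∣<n))) ⟩
    tent (2 * n) (2 * ∣ k - m ∣)           ≡⟨ cong ((2 * ∣ k - m ∣) ⊓_) (*-distribˡ-∸ 2 n ∣ k - m ∣) ⟨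
    (2 * ∣ k - m ∣) ⊓ (2 * (n ∸ ∣ k - m ∣)) ≡⟨ *-distribˡ-⊓ 2 ∣ k - m ∣ (n ∸ ∣ k - m ∣) ⟨
    2 * tent n ∣ k - m ∣                   ∎
    where
    open ≡-Reasoning
    ∣odd-odd∣ : ∣ 2 * k + 1 - 2 * m + 1 ∣ ≡ 2 * ∣ k - m ∣
    ∣odd-odd∣ = trans (cong₂ ∣_-_∣ (+-comm (2 * k) 1) (+-comm (2 * m) 1))
                      (trans (∣m+n-m+o∣≡∣n-o∣ 1 (2 * k) (2 * m)) (sym (*-distribˡ-∣-∣ 2 k m)))
    ∣k-m∣<n : ∣ k - m ∣ < n
    ∣k-m∣<n = ≤-<-trans (∣m-n∣≤m⊔n k m) (⊔-lub k<n m<n)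

  dWW≡spokeDist : ∀ {k m} → k < n → m < n → dWW k m ≡ spokeDist ∣ k - m ∣
  dWW≡spokeDist {k} {m} k<n m<n with k ≟ m
  ... | yes refl = trans (dWW-self k) (cong spokeDist (sym (∣n-n∣≡0 k)))
  ... | no  k≢m = trans (dWW-≢ k≢m) (trans (cong (2 +_) (γ-cd-odd k<n m<n))
                     (sym (spokeDist-pos (n≢0⇒n>0 (k≢m ∘ ∣m-n∣≡0⇒m≡n)))))

  row-ww : ∀ {k} → k < n → Σ< n (dWW k) + 2 ≡ 2 * n + 2 * Σ< n (tent n)
  row-ww {k} k<n = begin
    Σ< n (dWW k) + 2                        ≡⟨ cong (_+ 2) (Σ<-cong n (λ m m<n → dWW≡spokeDist k<n m<n)) ⟩
    Σ< n (λ m → spokeDist ∣ k - m ∣) + 2    ≡⟨ cong (_+ 2) (Σ<-∣-∣ n spokeDist k<n reflect) ⟩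
    Σ< n spokeDist + 2                      ≡⟨ count n refl ⟩
    2 * n + 2 * Σ< n (tent n)               ∎
    where
    open ≡-Reasoning
    reflect : ∀ {t} → 0 < t → t < n → spokeDist (n ∸ t) ≡ spokeDist t
    reflect 0<t t<n = trans (spokeDist-pos (m<n⇒0<n∸m t<n))
      (trans (cong (λ c → 2 + 2 * c) (tent-reflect (<⇒≤ t<n))) (sym (spokeDist-pos 0<t)))
    count : ∀ K → K ≡ n → Σ< K spokeDist + 2 ≡ 2 * K + 2 * Σ< K (tent n)
    count zero    K≡n = ⊥-elim (<-irrefl K≡n (≤-trans (s≤s z≤n) 2≤n))
    count (suc K) _   = begin
      Σ< K (λ e → 2 + 2 * tent n (suc e)) + 2                 ≡⟨ cong (_+ 2) (Σ<-+ K (λ _ → 2) (λ e → 2 * tent n (suc e))) ⟩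
      Σ< K (λ _ → 2) + Σ< K (λ e → 2 * tent n (suc e)) + 2    ≡⟨ cong₂ (λ a b → a + b + 2) (Σ<-const K 2) (Σ<-* K 2 (tent n ∘ suc)) ⟩
      K * 2 + 2 * Σ< K (tent n ∘ suc) + 2                     ≡⟨ regroup K (Σ< K (tent n ∘ suc)) ⟩
      2 * suc K + 2 * Σ< K (tent n ∘ suc)                     ∎
      where
      regroup : ∀ K s → K * 2 + 2 * s + 2 ≡ 2 * suc K + 2 * s
      regroup = solve-∀

  weight : ℕ → ℕ → ℕ
  weight a b = deg (P′ n) a * deg (P′ n) b * dist (P′ n) a b

  weight-uu : ∀ {x y} → x < M → y < M → weight x y ≡ 9 * dUU x y
  weight-uu {x} {y} x<M y<M rewrite deg-cycle x<M | deg-cycle y<M | dist≡D (cycle<5n x<M) (cycle<5n y<M) | D-uu x<M y<M = refl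

  weight-uw : ∀ {x m} → x < M → m < n → weight x (W + m) ≡ 6 * dUW x m
  weight-uw {x} {m} x<M m<n rewrite deg-cycle x<M | deg-spoke m<n | dist≡D (cycle<5n x<M) (spoke<5n m<n) | D-uw m x<M = refl

  weight-wu : ∀ {k y} → k < n → y < M → weight (W + k) y ≡ 6 * dUW y k
  weight-wu {k} {y} k<n y<M rewrite deg-spoke k<n | deg-cycle y<M | dist≡D (spoke<5n k<n) (cycle<5n y<M) | D-wu k y<M = refl

  weight-ww : ∀ {k m} → k < n → m < n → weight (W + k) (W + m) ≡ 4 * dWW k m
  weight-ww {k} {m} k<n m<n rewrite deg-spoke k<n | deg-spoke m<n | dist≡D (spoke<5n k<n) (spoke<5n m<n) | D-ww k m = refl

  block-uu : Σ< M (λ x → Σ< M (weight x)) + 9 * M ≡ 9 * (M * (2 * (n * n + n)) + L)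
  block-uu = begin
    Σ< M (λ x → Σ< M (weight x)) + 9 * M
      ≡⟨ cong (_+ 9 * M) (Σ<-cong M (λ x x<M → trans (Σ<-cong M (λ y y<M → weight-uu x<M y<M)) (Σ<-* M 9 (dUU x)))) ⟩
    Σ< M (λ x → 9 * Σ< M (dUU x)) + 9 * M
      ≡⟨ cong (_+ 9 * M) (Σ<-* M 9 _) ⟩
    9 * Σ< M (λ x → Σ< M (dUU x)) + 9 * M
      ≡⟨ *-distribˡ-+ 9 (Σ< M (λ x → Σ< M (dUU x))) M ⟨
    9 * (Σ< M (λ x → Σ< M (dUU x)) + M)
      ≡⟨ cong (λ s → 9 * (Σ< M (λ x → Σ< M (dUU x)) + s)) (trans (sym (*-identityʳ M)) (sym (Σ<-const M 1))) ⟩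
    9 * (Σ< M (λ x → Σ< M (dUU x)) + Σ< M (λ _ → 1))
      ≡⟨ cong (9 *_) (Σ<-+ M (λ x → Σ< M (dUU x)) (λ _ → 1)) ⟨
    9 * Σ< M (λ x → Σ< M (dUU x) + 1)
      ≡⟨ cong (9 *_) (Σ<-cong M (λ x x<M → row-uu x<M)) ⟩
    9 * Σ< M (λ x → 2 * (n * n + n) + oddness (parity x))
      ≡⟨ cong (9 *_) (Σ<-+ M _ _) ⟩
    9 * (Σ< M (λ _ → 2 * (n * n + n)) + Σ< M (oddness ∘ parity))
      ≡⟨ cong₂ (λ a b → 9 * (a + b)) (Σ<-const M _) odd-count ⟩
    9 * (M * (2 * (n * n + n)) + L)
      ∎
    where
    open ≡-Reasoning
    odd-count : Σ< M (oddness ∘ parity) ≡ L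
    odd-count = trans (cong (λ K → Σ< K (oddness ∘ parity)) (cong (L +_) (sym (+-identityʳ L))))
                      (trans (Σ<-parity L oddness) (*-identityʳ L))

  block-uw : Σ< M (λ x → Σ< n (λ m → weight x (W + m))) ≡ 6 * (n * (2 * L + 2 * (n * n)))
  block-uw = begin
    Σ< M (λ x → Σ< n (λ m → weight x (W + m)))
      ≡⟨ Σ<-cong M (λ x x<M → Σ<-cong n (λ m m<n → weight-uw x<M m<n)) ⟩
    Σ< M (λ x → Σ< n (λ m → 6 * dUW x m))
      ≡⟨ Σ<-swap M n _ ⟩
    Σ< n (λ m → Σ< M (λ x → 6 * dUW x m))
      ≡⟨ Σ<-const-on n (λ m m<n → trans (Σ<-* M 6 (λ x → dUW x m)) (cong (6 *_) (row-uw m<n))) ⟩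
    n * (6 * (2 * L + 2 * (n * n)))
      ≡⟨ *-left-comm n 6 _ ⟩
    6 * (n * (2 * L + 2 * (n * n)))
      ∎
    where open ≡-Reasoning

  block-wu : Σ< n (λ k → Σ< M (λ y → weight (W + k) y)) ≡ 6 * (n * (2 * L + 2 * (n * n)))
  block-wu = begin
    Σ< n (λ k → Σ< M (λ y → weight (W + k) y))
      ≡⟨ Σ<-const-on n (λ k k<n → trans (Σ<-cong M (λ y y<M → weight-wu k<n y<M))
                                        (trans (Σ<-* M 6 (λ y → dUW y k)) (cong (6 *_) (row-uw k<n)))) ⟩
    n * (6 * (2 * L + 2 * (n * n)))
      ≡⟨ *-left-comm n 6 _ ⟩
    6 * (n * (2 * L + 2 * (n * n)))
      ∎
    where open ≡-Reasoning

  block-ww : Σ< n (λ k → Σ< n (λ m → weight (W + k) (W + m))) + 8 * n ≡ 4 * (n * (2 * n + 2 * Σ< n (tent n)))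
  block-ww = begin
    Σ< n (λ k → Σ< n (λ m → weight (W + k) (W + m))) + 8 * n
      ≡⟨ cong (_+ 8 * n) (Σ<-cong n (λ k k<n → trans (Σ<-cong n (λ m m<n → weight-ww k<n m<n)) (Σ<-* n 4 (dWW k)))) ⟩
    Σ< n (λ k → 4 * Σ< n (dWW k)) + 8 * n
      ≡⟨ cong₂ _+_ (Σ<-* n 4 _) (*-assoc 4 2 n) ⟩
    4 * Σ< n (λ k → Σ< n (dWW k)) + 4 * (2 * n)
      ≡⟨ *-distribˡ-+ 4 (Σ< n (λ k → Σ< n (dWW k))) (2 * n) ⟨
    4 * (Σ< n (λ k → Σ< n (dWW k)) + 2 * n)
      ≡⟨ cong (λ s → 4 * (Σ< n (λ k → Σ< n (dWW k)) + s)) (trans (*-comm 2 n) (sym (Σ<-const n 2))) ⟩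
    4 * (Σ< n (λ k → Σ< n (dWW k)) + Σ< n (λ _ → 2))
      ≡⟨ cong (4 *_) (Σ<-+ n (λ k → Σ< n (dWW k)) (λ _ → 2)) ⟨
    4 * Σ< n (λ k → Σ< n (dWW k) + 2)
      ≡⟨ cong (4 *_) (Σ<-const-on n (λ k k<n → row-ww k<n)) ⟩
    4 * (n * (2 * n + 2 * Σ< n (tent n)))
      ∎
    where open ≡-Reasoning

  weightSum : ℕ
  weightSum = Σ< (5 * n) (λ a → Σ< (5 * n) (weight a))

  gutman≡weightSum/2 : gutman (P′ n) ≡ weightSum / 2
  gutman≡weightSum/2 = cong (_/ 2) (trans (sum-map-upTo (5 * n) _)
                                          (Σ<-cong (5 * n) (λ a _ → sum-map-upTo (5 * n) (weight a))))

  weightSum-blocks : weightSum ≡ (Σ< M (λ x → Σ< M (weight x)) + Σ< M (λ x → Σ< n (λ m → weight x (W + m))))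
                               + (Σ< n (λ k → Σ< M (λ y → weight (W + k) y)) + Σ< n (λ k → Σ< n (λ m → weight (W + k) (W + m))))
  weightSum-blocks = begin
    weightSum
      ≡⟨ Σ<-vertices _ ⟩
    Σ< M (λ x → Σ< (5 * n) (weight x)) + Σ< n (λ k → Σ< (5 * n) (weight (W + k)))
      ≡⟨ cong₂ _+_ (trans (Σ<-cong M (λ x _ → Σ<-vertices (weight x))) (Σ<-+ M _ _))
                   (trans (Σ<-cong n (λ k _ → Σ<-vertices (weight (W + k)))) (Σ<-+ n _ _)) ⟩
    _ ∎
    where open ≡-Reasoning

  weightSum-closed : weightSum + 44 * n ≡ chainPolynomial n (Σ< n (tent n))
  weightSum-closed = begin
    weightSum + 44 * n
      ≡⟨ cong (_+ 44 * n) weightSum-blocks ⟩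
    (Suu + Suw) + (Swu + Sww) + 44 * n
      ≡⟨ regroup Suu Suw Swu Sww n ⟩
    (Suu + 9 * M) + Suw + Swu + (Sww + 8 * n)
      ≡⟨ cong₂ _+_ (cong₂ _+_ (cong₂ _+_ block-uu block-uw) block-wu) block-ww ⟩
    9 * (M * (2 * (n * n + n)) + L) + 6 * (n * (2 * L + 2 * (n * n))) + 6 * (n * (2 * L + 2 * (n * n)))
      + 4 * (n * (2 * n + 2 * Σ< n (tent n)))
      ≡⟨ chainPolynomial-blocks n (Σ< n (tent n)) ⟩
    chainPolynomial n (Σ< n (tent n))
      ∎
    where
    open ≡-Reasoning
    Suu = Σ< M (λ x → Σ< M (weight x))
    Suw = Σ< M (λ x → Σ< n (λ m → weight x (W + m)))
    Swu = Σ< n (λ k → Σ< M (λ y → weight (W + k) y))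
    Sww = Σ< n (λ k → Σ< n (λ m → weight (W + k) (W + m)))
    regroup : ∀ a b c d n → (a + b) + (c + d) + 44 * n ≡ (a + 9 * (2 * n + 2 * n)) + b + c + (d + 8 * n)
    regroup = solve-∀

/2-exact : ∀ t z d → t + 2 * d ≡ 2 * z → t / 2 ≡ z ∸ d
/2-exact t z d eq = begin
  t / 2                   ≡⟨ cong (_/ 2) t≡ ⟩
  (z ∸ d) * 2 / 2         ≡⟨ m*n/n≡m (z ∸ d) 2 ⟩
  z ∸ d                   ∎
  where
  open ≡-Reasoning
  t≡ : t ≡ (z ∸ d) * 2
  t≡ = begin
    t                     ≡⟨ m+n∸n≡m t (2 * d) ⟨
    t + 2 * d ∸ 2 * d     ≡⟨ cong (_∸ 2 * d) eq ⟩
    2 * z ∸ 2 * d         ≡⟨ *-distribˡ-∸ 2 z d ⟨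
    2 * (z ∸ d)           ≡⟨ *-comm 2 (z ∸ d) ⟩
    (z ∸ d) * 2           ∎

chainPolynomial-even : ∀ q → chainPolynomial (q + q) (q * q)
                               ≡ 2 * (49 * (q + q) ^ 3 + 64 * (q + q) ^ 2) + 18 * (q + q)
chainPolynomial-even = expanded
  where
  -- The ring solver does not accept _^_, so the powers are unfolded by hand.
  expanded : ∀ q → 96 * ((q + q) * (q + q) * (q + q)) + 128 * ((q + q) * (q + q)) + 18 * (q + q) + 8 * (q + q) * (q * q)
                 ≡ 2 * (49 * ((q + q) * ((q + q) * ((q + q) * 1))) + 64 * ((q + q) * ((q + q) * 1))) + 18 * (q + q)
  expanded = solve-∀

chainPolynomial-odd : ∀ q → chainPolynomial (suc (q + q)) (q * q + q)
                              ≡ 2 * (49 * suc (q + q) ^ 3 + 64 * suc (q + q) ^ 2) + 16 * suc (q + q)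
chainPolynomial-odd = expanded
  where
  expanded : ∀ q → 96 * (suc (q + q) * suc (q + q) * suc (q + q)) + 128 * (suc (q + q) * suc (q + q)) + 18 * suc (q + q)
                   + 8 * suc (q + q) * (q * q + q)
                 ≡ 2 * (49 * (suc (q + q) * (suc (q + q) * (suc (q + q) * 1))) + 64 * (suc (q + q) * (suc (q + q) * 1)))
                   + 16 * suc (q + q)
  expanded = solve-∀

gutman-P′≡ : ∀ n → 2 ≤ n → ∀ d e →
  chainPolynomial n (Σ< n (tent n)) ≡ 2 * (49 * n ^ 3 + 64 * n ^ 2) + e → 2 * d + e ≡ 44 * n →
  gutman (P′ n) ≡ 49 * n ^ 3 + 64 * n ^ 2 ∸ d
gutman-P′≡ n 2≤n d e poly 2d+e≡44n = trans gutman≡weightSum/2 (/2-exact weightSum _ d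
  (+-cancelʳ-≡ e (weightSum + 2 * d) _ (begin
    weightSum + 2 * d + e                       ≡⟨ +-assoc weightSum (2 * d) e ⟩
    weightSum + (2 * d + e)                     ≡⟨ cong (weightSum +_) 2d+e≡44n ⟩
    weightSum + 44 * n                          ≡⟨ weightSum-closed ⟩
    chainPolynomial n (Σ< n (tent n))           ≡⟨ poly ⟩
    2 * (49 * n ^ 3 + 64 * n ^ 2) + e           ∎)))
  where
  open ChainSums n 2≤n
  open ≡-Reasoning

%2≡0⇒≡half+half : ∀ n → n % 2 ≡ 0 → n ≡ n / 2 + n / 2
%2≡0⇒≡half+half n n%2≡0 = trans (m≡m%n+[m/n]*n n 2) (trans (cong (_+ n / 2 * 2) n%2≡0) (trans (*-comm (n / 2) 2) (cong (n / 2 +_) (+-identityʳ (n / 2)))))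

%2≡1⇒≡1+half+half : ∀ n → n % 2 ≡ 1 → n ≡ suc (n / 2 + n / 2)
%2≡1⇒≡1+half+half n n%2≡1 = trans (m≡m%n+[m/n]*n n 2) (trans (cong (_+ n / 2 * 2) n%2≡1) (cong suc (trans (*-comm (n / 2) 2) (cong (n / 2 +_) (+-identityʳ (n / 2))))))

theorem9 : ∀ (n : ℕ) → 2 ≤ n →
    (n % 2 ≡ 0 → gutman (P′ n) ≡ 49 * n ^ 3 + 64 * n ^ 2 ∸ 13 * n)
    × (n % 2 ≡ 1 → gutman (P′ n) ≡ 49 * n ^ 3 + 64 * n ^ 2 ∸ 14 * n)
theorem9 n 2≤n = even , odd
  where
  even : n % 2 ≡ 0 → gutman (P′ n) ≡ 49 * n ^ 3 + 64 * n ^ 2 ∸ 13 * n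
  even n%2≡0 with q ← n / 2 | refl ← %2≡0⇒≡half+half n n%2≡0 =
    gutman-P′≡ (q + q) 2≤n (13 * (q + q)) (18 * (q + q))
      (trans (cong (chainPolynomial (q + q)) (Σ<-tent-even q)) (chainPolynomial-even q)) (26n+18n≡44n (q + q))
    where
    26n+18n≡44n : ∀ n → 2 * (13 * n) + 18 * n ≡ 44 * n
    26n+18n≡44n = solve-∀
  odd : n % 2 ≡ 1 → gutman (P′ n) ≡ 49 * n ^ 3 + 64 * n ^ 2 ∸ 14 * n
  odd n%2≡1 with q ← n / 2 | refl ← %2≡1⇒≡1+half+half n n%2≡1 =
    gutman-P′≡ (suc (q + q)) 2≤n (14 * suc (q + q)) (16 * suc (q + q))
      (trans (cong (chainPolynomial (suc (q + q))) (Σ<-tent-odd q)) (chainPolynomial-odd q)) (28n+16n≡44n (suc (q + q)))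
    where
    28n+16n≡44n : ∀ n → 2 * (14 * n) + 16 * n ≡ 44 * n
    28n+16n≡44n = solve-∀
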